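{- Let $G$ be a connected graph with vertex set $V(G)=\{1,2,\dots,n\}$ and diameter $d$. Then \[\det(AD(G))=\sum_{\mathcal S}(-1)^{\,n-p(\mathcal S)-p_1(\mathcal S)}\,2^{p_1(\mathcal S)}\,d^{\,2a(\mathcal S)+a_1(\mathcal S)},\] where the sum runs over all spanning adjacency-diametrical partitions $\mathcal S$ of $G$.
   Context: All graphs are finite, simple, undirected. For a connected graph $G$ with diameter $d$ and distance $d_G$, two distinct vertices $u,v$ are antipodal if $d_G(u,v)=d$. The adjacency-diametrical matrix $AD(G)$ is the matrix indexed by the vertices whose $(u,v)$-entry is $1$ if $d_G(u,v)=1$, $d$ if $d_G(u,v)=d$, and $0$ otherwise. An adjacency-diametrical cycle of length $k\ge 3$ is a cyclic arrangement $(u_1,\dots,u_k)$ of $k$ distinct vertices (considered up to rotation and reversal) such that for every $i$ (indices mod $k$) $u_i$ and $u_{i+1}$ are adjacent or antipodal; different cyclic arrangements of the same vertex set are different cycles. An adjacency-diametrical partition $\mathcal S$ of $G$ is a collection of pairwise disjoint parts, each either (a) a $2$-element set $\{u,v\}$ with $u,v$ adjacent or antipodal, or (b) an adjacency-diametrical cycle of length $\ge 3$ (vertex set together with its cyclic arrangement); it is spanning if the parts cover $V(G)$. $p(\mathcal S)$ and $p_1(\mathcal S)$ are the numbers of parts of type (a) and (b) respectively; $a(\mathcal S)$ is the number of type-(a) parts whose two vertices are antipodal; $a_1(\mathcal S)$ is the total number, over all type-(b) parts, of consecutive pairs $u_i,u_{i+1}$ that are antipodal. -}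

module Defs where

open import Data.Bool using (Bool; true; false; _∧_; _∨_; not; if_then_else_; T)
open import Data.Nat as ℕ using (ℕ; zero; suc; _⊔_; _≡ᵇ_; _∸_)
open import Data.Fin using (Fin; zero; suc; toℕ; punchIn; _<_)
open import Data.Fin.Properties using (_≟_)
open import Data.Integer as ℤ using (ℤ; +_; -_)
open import Data.List using (List; []; _∷_; foldr; map; allFin; concatMap; concat; length)
open import Data.Bool.ListAction using (any)
open import Data.List.Relation.Unary.All using (All)
open import Data.List.Relation.Unary.Linked using (Linked)
open import Data.List.Relation.Unary.Unique.Propositional using (Unique)
open import Data.List.Relation.Binary.Permutation.Propositional using (_↭_)
open import Data.Product using (_×_; _,_; ∃)
open import Relation.Nullary.Decidable using (⌊_⌋)
open import Relation.Binary.PropositionalEquality using (_≡_)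

record Graph (n : ℕ) : Set where
  field
    adj     : Fin n → Fin n → Bool
    sym     : ∀ u v → adj u v ≡ adj v u
    irrefl  : ∀ u → adj u u ≡ false
open Graph public

module _ {n : ℕ} (G : Graph n) where

  reach : ℕ → Fin n → Fin n → Bool
  reach zero    u v = ⌊ u ≟ v ⌋
  reach (suc k) u v = reach k u v ∨ any (λ w → reach k u w ∧ adj G w v) (allFin n)

  Connected : Set
  Connected = ∀ u v → ∃ λ k → reach k u v ≡ true

  -- least k ≤ b with p k, (b if none)
  least : (ℕ → Bool) → ℕ → ℕ
  least p zero    = zero
  least p (suc b) = if p zero then zero else suc (least (λ k → p (suc k)) b)

  -- graph distance d_G(u,v) (a shortest walk has length < n in a connected graph)
  dist : Fin n → Fin n → ℕ
  dist u v = least (λ k → reach k u v) n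

  diam : ℕ
  diam = foldr _⊔_ 0 (concatMap (λ u → map (λ v → dist u v) (allFin n)) (allFin n))

  isAdj : Fin n → Fin n → Bool
  isAdj = adj G

  isAntipodal : Fin n → Fin n → Bool
  isAntipodal u v = not ⌊ u ≟ v ⌋ ∧ (dist u v ≡ᵇ diam)

  AD : Fin n → Fin n → ℤ
  AD u v = if dist u v ≡ᵇ 1 then + 1 else (if dist u v ≡ᵇ diam then + diam else + 0)

sumℤ : List ℤ → ℤ
sumℤ = foldr ℤ._+_ (+ 0)

signℤ : ℕ → ℤ
signℤ k = (- (+ 1)) ℤ.^ k

det : ∀ m → (Fin m → Fin m → ℤ) → ℤ
det zero    M = + 1
det (suc m) M =
  sumℤ (map (λ j → signℤ (toℕ j) ℤ.* (M zero j ℤ.* det m (λ i k → M (suc i) (punchIn j k))))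
            (allFin (suc m)))

-- A part is a list (u₁,…,u_k), k ≥ 2, of distinct vertices:
--   k = 2 : the 2-element set {u₁,u₂}, listed with u₁ < u₂      (type (a))
--   k ≥ 3 : the cycle (u₁,…,u_k) up to rotation and reversal,
--           listed with u₁ the least vertex and u₂ < u_k          (type (b))
-- A partition is a list of parts, listed by strictly increasing first vertex.

lastOf : ∀ {A : Set} → A → List A → A
lastOf x []       = x
lastOf x (y ∷ ys) = lastOf y ys

cyclePairs : ∀ {A : Set} → List A → List (A × A)
cyclePairs []       = []
cyclePairs (x ∷ xs) = go x xs
  where
  go : _ → List _ → List (_ × _)
  go y []       = (y , x) ∷ []
  go y (z ∷ zs) = (y , z) ∷ go z zs

data Canonical {n : ℕ} : List (Fin n) → Set where
  pair  : ∀ {u v} → u < v → Canonical (u ∷ v ∷ [])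
  cycle : ∀ {u v w rest} → All (u <_) (v ∷ w ∷ rest) → v < lastOf w rest →
          Canonical (u ∷ v ∷ w ∷ rest)

data HeadLt {n : ℕ} : List (Fin n) → List (Fin n) → Set where
  headLt : ∀ {u v us vs} → u < v → HeadLt (u ∷ us) (v ∷ vs)

module _ {n : ℕ} (G : Graph n) where

  AdjOrAntipodal : Fin n × Fin n → Set
  AdjOrAntipodal (u , v) = T (isAdj G u v ∨ isAntipodal G u v)

  ValidPart : List (Fin n) → Set
  ValidPart P = Canonical P × Unique P × All AdjOrAntipodal (cyclePairs P)

  SpanningADPartition : List (List (Fin n)) → Set
  SpanningADPartition S = All ValidPart S × Linked HeadLt S × (concat S ↭ allFin n)

  count : ∀ {A : Set} → (A → Bool) → List A → ℕ
  count f = foldr (λ x r → if f x then suc r else r) 0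

  isPairPart : List (Fin n) → Bool
  isPairPart P = length P ≡ᵇ 2

  pS : List (List (Fin n)) → ℕ
  pS = count isPairPart

  p₁S : List (List (Fin n)) → ℕ
  p₁S = count (λ P → not (isPairPart P))

  pairAntipodal : List (Fin n) → Bool
  pairAntipodal (u ∷ v ∷ []) = isAntipodal G u v
  pairAntipodal _            = false

  aS : List (List (Fin n)) → ℕ
  aS = count pairAntipodal

  a₁S : List (List (Fin n)) → ℕ
  a₁S S = foldr ℕ._+_ 0
    (map (λ P → if isPairPart P then 0
                else count (λ e → isAntipodal G (Data.Product.proj₁ e) (Data.Product.proj₂ e)) (cyclePairs P)) S)

  weight : List (List (Fin n)) → ℤ
  weight S = signℤ (n ∸ pS S ∸ p₁S S) ℤ.*
             ((+ (2 ℕ.^ p₁S S)) ℤ.* (+ (diam G ℕ.^ (2 ℕ.* aS S ℕ.+ a₁S S))))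

{-# OPTIONS --safe #-}
-- Expand the determinant along the row of the least vertex v, then along the row of each vertex
-- reached: det AD is the sum, over simple paths v → s₁ → ⋯ → sₘ → v, of (-1)ᵐ times the product
-- of the entries along the path times the principal minor on the remaining vertices.  The empty
-- path vanishes since AD has zero diagonal, and as AD is symmetric a path and its reverse
-- contribute equally, so every cycle through v is counted once per orientation: twice if it has at
-- least three vertices, once if it is an edge traversed back and forth.  Induction on the remaining
-- vertices gives a sum over all partitions into such cycles.  An entry of AD is 1 on adjacent pairs,
-- d on antipodal ones and 0 otherwise, so exactly the adjacency-diametrical partitions survive, each
-- with the weight (-1)^(n - p - p₁) 2^p₁ d^(2a + a₁).
module Submission where

open import Defs
open import Data.Nat using (ℕ)
open import Data.List using (List)
open import Data.Fin using (Fin)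
open import Data.List.Relation.Unary.Unique.Propositional using (Unique)
open import Data.List.Membership.Propositional using (_∈_)
open import Function.Bundles using (_⇔_)
open import Relation.Binary.PropositionalEquality using (_≡_)

open import Data.Bool using (Bool; true; false; T; not; _∧_; _∨_; if_then_else_)
import Data.Bool.Properties as Bool
open import Data.Empty using (⊥; ⊥-elim)
open import Data.Unit using (tt)
open import Data.Nat as ℕ using (zero; suc; _≤_; _∸_; _^_; _≡ᵇ_)
import Data.Nat.Properties as ℕ
open import Data.Integer as ℤ using (ℤ; +_; -_; _+_; _-_; _*_)
import Data.Integer.Properties as ℤ
open import Data.Integer.Tactic.RingSolver using (solve-∀)
open import Data.Fin as Fin using (_<_; toℕ; punchIn)
open import Data.Fin.Properties using (_≟_; _<?_; <-cmp; <⇒≢)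
open import Data.Product as Product using (_×_; _,_; proj₁; proj₂; ∃; ∃₂)
open import Data.Sum using (_⊎_; inj₁; inj₂; [_,_]′)
open import Data.List using ([]; _∷_; _++_; [_]; _∷ʳ_; map; concat; concatMap; length; filter; reverse; drop; tabulate; allFin)
import Data.List.Properties as List
open import Data.List.Membership.Propositional using (_∉_; find; lose)
open import Data.List.Membership.Propositional.Properties
  using (∈-map⁺; ∈-map⁻; ∈-concatMap⁺; ∈-concatMap⁻; ∈-filter⁺; ∈-filter⁻; ∈-∃++; ∈-++⁺ˡ; ∈-++⁺ʳ; ∈-++⁻; ∈-allFin)
open import Data.List.Membership.Propositional.Properties.WithK using (unique∧set⇒bag)
open import Data.List.Relation.Binary.BagAndSetEquality using (∼bag⇒↭)
open import Data.List.Relation.Binary.Permutation.Propositional using (_↭_; ↭-refl; ↭-prep; ↭-sym; ↭-trans; ↭⇒↭ₛ)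
import Data.List.Relation.Binary.Permutation.Propositional.Properties as ↭
open import Data.List.Relation.Binary.Permutation.Setoid.Properties using (foldr-commMonoid; Unique-resp-↭)
open import Data.List.Relation.Unary.All as All using (All; []; _∷_)
import Data.List.Relation.Unary.All.Properties as All
open import Data.List.Relation.Unary.AllPairs as AllPairs using (AllPairs; []; _∷_)
import Data.List.Relation.Unary.AllPairs.Properties as AllPairs
open import Data.List.Relation.Unary.Any as Any using (here; there)
import Data.List.Relation.Unary.Any.Properties as Any
open import Data.List.Relation.Unary.Linked as Linked using (Linked; []; [-]; _∷_)
import Data.List.Relation.Unary.Unique.Propositional.Properties as Unique
open import Function using (_∘_; _on_)
open import Function.Bundles using (Equivalence; mk⇔)
import Function.Properties.Equivalence as ⇔
open import Relation.Nullary using (¬_; does; yes; no)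
open import Relation.Nullary.Decidable using (⌊_⌋; T?; dec-true; dec-false; toWitness; fromWitness; fromWitnessFalse)
open import Relation.Unary using (Decidable)
open import Relation.Unary.Properties using (_∩?_)
open import Relation.Binary.Definitions using (DecidableEquality; tri<; tri≈; tri>)
open import Relation.Binary.PropositionalEquality using (_≢_; refl; trans; cong; cong₂; subst; module ≡-Reasoning)
import Relation.Binary.PropositionalEquality as ≡
open import Algebra.Properties.CommutativeSemigroup ℤ.+-commutativeSemigroup using (interchange)
open import Algebra.Properties.CommutativeSemigroup ℤ.*-commutativeSemigroup using (x∙yz≈y∙xz)
import Algebra.Properties.CommutativeSemigroup ℕ.+-commutativeSemigroup as ℕ+

↭-unique : ∀ {A : Set} {xs ys : List A} → Unique xs → Unique ys → (∀ {x} → x ∈ xs ⇔ x ∈ ys) → xs ↭ ys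
↭-unique xs! ys! xs∼ys = ∼bag⇒↭ (unique∧set⇒bag xs! ys! xs∼ys)

∑ : ∀ {A : Set} → (A → ℤ) → List A → ℤ
∑ f xs = sumℤ (map f xs)

infix 5 ∑
syntax ∑ (λ x → e) xs = ∑[ x ∈ xs ] e

module _ {A : Set} where

  ∑-cong : ∀ {f g : A → ℤ} xs → (∀ {x} → x ∈ xs → f x ≡ g x) → ∑ f xs ≡ ∑ g xs
  ∑-cong []       f≡g = refl
  ∑-cong (x ∷ xs) f≡g = cong₂ _+_ (f≡g (here refl)) (∑-cong xs (λ x∈xs → f≡g (there x∈xs)))

  ∑-++ : ∀ (f : A → ℤ) xs ys → ∑ f (xs ++ ys) ≡ ∑ f xs + ∑ f ys
  ∑-++ f []       ys = ≡.sym (ℤ.+-identityˡ _)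
  ∑-++ f (x ∷ xs) ys = trans (cong (λ z → f x + z) (∑-++ f xs ys)) (≡.sym (ℤ.+-assoc (f x) _ _))

  ∑-map : ∀ {B : Set} (f : A → ℤ) (g : B → A) xs → ∑ f (map g xs) ≡ ∑[ x ∈ xs ] f (g x)
  ∑-map f g xs = cong sumℤ (≡.sym (List.map-∘ xs))

  ∑-concatMap : ∀ {B : Set} (f : A → ℤ) (g : B → List A) xs →
                ∑ f (concatMap g xs) ≡ ∑[ x ∈ xs ] ∑ f (g x)
  ∑-concatMap f g []       = refl
  ∑-concatMap f g (x ∷ xs) =
    trans (∑-++ f (g x) _) (cong (λ z → ∑ f (g x) + z) (∑-concatMap f g xs))

  ∑-+ : ∀ (f g : A → ℤ) xs → ∑[ x ∈ xs ] (f x + g x) ≡ ∑ f xs + ∑ g xs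
  ∑-+ f g []       = refl
  ∑-+ f g (x ∷ xs) = trans (cong (λ z → f x + g x + z) (∑-+ f g xs)) (interchange (f x) (g x) _ _)

  ∑-*ˡ : ∀ c (f : A → ℤ) xs → ∑[ x ∈ xs ] (c * f x) ≡ c * ∑ f xs
  ∑-*ˡ c f []       = ≡.sym (ℤ.*-zeroʳ c)
  ∑-*ˡ c f (x ∷ xs) =
    trans (cong (λ z → c * f x + z) (∑-*ˡ c f xs)) (≡.sym (ℤ.*-distribˡ-+ c (f x) _))

  ∑-neg : ∀ (f : A → ℤ) xs → ∑[ x ∈ xs ] (- f x) ≡ - ∑ f xs
  ∑-neg f []       = refl
  ∑-neg f (x ∷ xs) = trans (cong (λ z → - f x + z) (∑-neg f xs)) (≡.sym (ℤ.neg-distrib-+ (f x) _))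

  ∑-↭ : ∀ (f : A → ℤ) {xs ys} → xs ↭ ys → ∑ f xs ≡ ∑ f ys
  ∑-↭ f xs↭ys = foldr-commMonoid (≡.setoid ℤ) ℤ.+-0-isCommutativeMonoid (↭⇒↭ₛ (↭.map⁺ f xs↭ys))

  ∑-filter : ∀ {P : A → Set} (P? : Decidable P) (f : A → ℤ) xs →
             ∑ f (filter P? xs) ≡ ∑[ x ∈ xs ] (if does (P? x) then f x else + 0)
  ∑-filter P? f []       = refl
  ∑-filter P? f (x ∷ xs) with does (P? x)
  ... | true  = cong (λ z → f x + z) (∑-filter P? f xs)
  ... | false = trans (∑-filter P? f xs) (≡.sym (ℤ.+-identityˡ _))

  ∑-filter-vanishing : ∀ {P : A → Set} (P? : Decidable P) (f : A → ℤ) xs →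
                       (∀ {x} → x ∈ xs → ¬ P x → f x ≡ + 0) → ∑ f (filter P? xs) ≡ ∑ f xs
  ∑-filter-vanishing P? f xs vanish = trans (∑-filter P? f xs) (∑-cong xs kept)
    where
    kept : ∀ {x} → x ∈ xs → (if does (P? x) then f x else + 0) ≡ f x
    kept {x} x∈ with P? x
    ... | yes _  = refl
    ... | no ¬Px = ≡.sym (vanish x∈ ¬Px)

∑-allFin-suc : ∀ {m} (h : Fin (suc m) → ℤ) →
               ∑ h (allFin (suc m)) ≡ h Fin.zero + ∑ (λ j → h (Fin.suc j)) (allFin m)
∑-allFin-suc h =
  trans (cong sumℤ (List.map-tabulate (λ i → i) h))
        (cong (λ z → h Fin.zero + sumℤ z) (≡.sym (List.map-tabulate (λ i → i) (λ j → h (Fin.suc j)))))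

signℤ-suc : ∀ k x → signℤ (suc k) * x ≡ - (signℤ k * x)
signℤ-suc k x = neg-step (signℤ k) x
  where
  neg-step : ∀ s x → (- + 1 * s) * x ≡ - (s * x)
  neg-step = solve-∀

signℤ-sq : ∀ k → signℤ k * signℤ k ≡ + 1
signℤ-sq zero    = refl
signℤ-sq (suc k) = trans (neg-sq (signℤ k)) (signℤ-sq k)
  where
  neg-sq : ∀ s → (- + 1 * s) * (- + 1 * s) ≡ s * s
  neg-sq = solve-∀

filter-filter : ∀ {A : Set} {P Q : A → Set} (P? : Decidable P) (Q? : Decidable Q) xs →
                filter P? (filter Q? xs) ≡ filter (Q? ∩? P?) xs
filter-filter P? Q? []       = refl
filter-filter P? Q? (x ∷ xs) with does (Q? x)
... | false = filter-filter P? Q? xs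
... | true with does (P? x)
...   | true  = cong (x ∷_) (filter-filter P? Q? xs)
...   | false = filter-filter P? Q? xs

module _ {X Y Z : Set} (g : X → Y → Z) (h : X → List Y) where

  ∈-concatMap-map⁺ : ∀ {x y xs} → x ∈ xs → y ∈ h x → g x y ∈ concatMap (λ x → map (g x) (h x)) xs
  ∈-concatMap-map⁺ x∈ y∈ = ∈-concatMap⁺ _ (lose x∈ (∈-map⁺ (g _) y∈))

  ∈-concatMap-map⁻ : ∀ {z} xs → z ∈ concatMap (λ x → map (g x) (h x)) xs →
                     ∃₂ λ x y → x ∈ xs × y ∈ h x × z ≡ g x y
  ∈-concatMap-map⁻ xs z∈ with find (∈-concatMap⁻ _ z∈)
  ... | x , x∈ , z∈′ with ∈-map⁻ (g x) z∈′
  ...   | y , y∈ , z≡ = x , y , x∈ , y∈ , z≡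

  AllPairs-concatMap-map : ∀ {R : Z → Z → Set} xs →
    All (λ x → AllPairs (λ y y′ → R (g x y) (g x y′)) (h x)) xs →
    AllPairs (λ x x′ → ∀ y y′ → R (g x y) (g x′ y′)) xs →
    AllPairs R (concatMap (λ x → map (g x) (h x)) xs)
  AllPairs-concatMap-map {R} xs within across =
    AllPairs.concat⁺ (All.map⁺ (All.map AllPairs.map⁺ within)) (AllPairs.map⁺ (AllPairs.map all-related across))
    where
    all-related : ∀ {x x′} → (∀ y y′ → R (g x y) (g x′ y′)) →
                  All (λ z → All (R z) (map (g x′) (h x′))) (map (g x) (h x))
    all-related Rxx′ = All.map⁺ (All.universal (λ y → All.map⁺ (All.universal (Rxx′ y) _)) _)

Unique-++⁻ : ∀ {A : Set} (xs : List A) {ys} → Unique (xs ++ ys) → Unique ys × (∀ {x} → x ∈ xs → x ∉ ys)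
Unique-++⁻ []       ys! = ys! , λ ()
Unique-++⁻ (x ∷ xs) (x≢ ∷ xs++ys!) with Unique-++⁻ xs xs++ys!
... | ys! , disjoint = ys! , λ where
  (here refl) y∈ → All.lookup x≢ (∈-++⁺ʳ xs y∈) refl
  (there x∈)     → disjoint x∈

module _ {A : Set} where

  lastOf-∷ʳ : ∀ (x : A) ys y → lastOf x (ys ∷ʳ y) ≡ y
  lastOf-∷ʳ x []       y = refl
  lastOf-∷ʳ x (z ∷ zs) y = lastOf-∷ʳ z zs y

  reverse-∷ : ∀ (x : A) xs → ∃ λ ys → reverse (x ∷ xs) ≡ lastOf x xs ∷ ys
  reverse-∷ x []       = [] , refl
  reverse-∷ x (y ∷ ys) with reverse-∷ y ys
  ... | zs , eq = zs ∷ʳ x , trans (List.unfold-reverse x (y ∷ ys)) (cong (_∷ʳ x) eq)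

  lastOf-∈ : ∀ (x : A) xs → lastOf x xs ∈ x ∷ xs
  lastOf-∈ x []       = here refl
  lastOf-∈ x (y ∷ ys) = there (lastOf-∈ y ys)

  Unique-reverse : ∀ {xs : List A} → Unique xs → Unique (reverse xs)
  Unique-reverse {xs} = Unique-resp-↭ (≡.setoid A) (↭⇒↭ₛ (↭-sym (↭.↭-reverse xs)))

-- Splits and arrangements

module _ {A : Set} where

  splits : List A → List (List A × A × List A)
  splits []       = []
  splits (x ∷ xs) = ([] , x , xs) ∷ map (Product.map₁ (x ∷_)) (splits xs)

  pivot : List A × A × List A → A
  pivot (_ , k , _) = k

  remainder : List A × A × List A → List A
  remainder (pre , _ , post) = pre ++ post

  splits-sound : ∀ {xs pre k post} → (pre , k , post) ∈ splits xs → xs ≡ pre ++ k ∷ post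
  splits-sound {x ∷ xs} (here refl) = refl
  splits-sound {x ∷ xs} (there p∈) with ∈-map⁻ (Product.map₁ (x ∷_)) p∈
  ... | _ , q∈ , refl = cong (x ∷_) (splits-sound q∈)

  splits-complete : ∀ pre (k : A) post → (pre , k , post) ∈ splits (pre ++ k ∷ post)
  splits-complete []        k post = here refl
  splits-complete (x ∷ pre) k post = there (∈-map⁺ (Product.map₁ (x ∷_)) (splits-complete pre k post))

  map-pivot-splits : ∀ U → map pivot (splits U) ≡ U
  map-pivot-splits []       = refl
  map-pivot-splits (x ∷ xs) = cong (x ∷_) (trans (≡.sym (List.map-∘ (splits xs))) (map-pivot-splits xs))

  length-remove : ∀ pre (k : A) post → length (pre ++ k ∷ post) ≡ suc (length (pre ++ post))
  length-remove pre k post = begin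
      length (pre ++ k ∷ post)          ≡⟨ List.length-++ pre ⟩
      length pre ℕ.+ suc (length post)  ≡⟨ ℕ.+-suc (length pre) _ ⟩
      suc (length pre ℕ.+ length post)  ≡⟨ cong suc (List.length-++ pre) ⟨
      suc (length (pre ++ post))        ∎
    where open ≡-Reasoning

  prependPivot : List A × A × List A → List A × List A → List A × List A
  prependPivot σ = Product.map₁ (pivot σ ∷_)

  -- For length U ≤ fuel: the pairs (s , U without the entries of s), s a sequence of distinct entries of U.
  arrangements : ℕ → List A → List (List A × List A)
  arrangements zero       U = [ ([] , U) ]
  arrangements (suc fuel) U =
    ([] , U) ∷ concatMap (λ σ → map (prependPivot σ) (arrangements fuel (remainder σ))) (splits U)

module Arrangements {A : Set} (_≟_ : DecidableEquality A) where

  open import Data.List.Membership.DecPropositional _≟_ using (_∈?_; _∉?_)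

  infixl 6 _∖_
  _∖_ : List A → List A → List A
  U ∖ s = filter (_∉? s) U

  ∈-∖⁺ : ∀ {x U s} → x ∈ U → x ∉ s → x ∈ U ∖ s
  ∈-∖⁺ = ∈-filter⁺ (_∉? _)

  ∈-∖⁻ : ∀ {x} U s → x ∈ U ∖ s → x ∈ U × x ∉ s
  ∈-∖⁻ U s = ∈-filter⁻ (_∉? s)

  length-∖ : ∀ U s → length (U ∖ s) ≤ length U
  length-∖ U s = List.length-filter (_∉? s) U

  ∖-[] : ∀ U → U ∖ [] ≡ U
  ∖-[] U = List.filter-all (_∉? []) (All.tabulate (λ _ ()))

  ∖-∷ : ∀ U k s → U ∖ [ k ] ∖ s ≡ U ∖ (k ∷ s)
  ∖-∷ U k s = trans (filter-filter (_∉? s) (_∉? [ k ]) U) (List.filter-≐ _ _ (join , split) U)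
    where
    join : ∀ {x} → x ∉ [ k ] × x ∉ s → x ∉ k ∷ s
    join (x∉k , x∉s) (here x≡k)  = x∉k (here x≡k)
    join (x∉k , x∉s) (there x∈s) = x∉s x∈s
    split : ∀ {x} → x ∉ k ∷ s → x ∉ [ k ] × x ∉ s
    split x∉ = (λ { (here x≡k) → x∉ (here x≡k) }) , (λ x∈s → x∉ (there x∈s))

  ∖-reverse : ∀ U s → U ∖ reverse s ≡ U ∖ s
  ∖-reverse U s =
    List.filter-≐ (_∉? reverse s) (_∉? s)
                  ((λ x∉ x∈ → x∉ (Any.reverse⁺ x∈)) , (λ x∉ x∈ → x∉ (Any.reverse⁻ x∈))) U

  ++-∖-↭ : ∀ {U s} → Unique U → Unique s → All (_∈ U) s → s ++ U ∖ s ↭ U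
  ++-∖-↭ {U} {s} U! s! s⊆U = ↭-unique (Unique.++⁺ s! (Unique.filter⁺ _ U!) disjoint) U! (mk⇔ to from)
    where
    disjoint : ∀ {x} → x ∈ s × x ∈ U ∖ s → ⊥
    disjoint (x∈s , x∈) = proj₂ (∈-∖⁻ U s x∈) x∈s
    to : ∀ {x} → x ∈ s ++ U ∖ s → x ∈ U
    to x∈ = [ All.lookup s⊆U , proj₁ ∘ ∈-∖⁻ U s ]′ (∈-++⁻ s x∈)
    from : ∀ {x} → x ∈ U → x ∈ s ++ U ∖ s
    from {x} x∈U with x ∈? s
    ... | yes x∈s = ∈-++⁺ˡ x∈s
    ... | no x∉s  = ∈-++⁺ʳ s (∈-∖⁺ x∈U x∉s)

  ≢⇒∉[] : ∀ {x y : A} → x ≢ y → y ∉ [ x ]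
  ≢⇒∉[] x≢y (here y≡x) = x≢y (≡.sym y≡x)

  splits-∖ : ∀ {U pre k post} → Unique U → (pre , k , post) ∈ splits U → k ∈ U × pre ++ post ≡ U ∖ [ k ]
  splits-∖ {x ∷ xs} (x≢xs ∷ _) (here refl) =
    here refl , ≡.sym (trans (List.filter-reject (_∉? [ x ]) (λ x∉ → x∉ (here refl)))
                             (List.filter-all (_∉? [ x ]) (All.map ≢⇒∉[] x≢xs)))
  splits-∖ {x ∷ xs} (x≢xs ∷ xs!) (there split∈) with ∈-map⁻ (Product.map₁ (x ∷_)) split∈
  ... | (pre , k , post) , split∈′ , refl =
    let k∈xs , rest≡ = splits-∖ xs! split∈′
        x≢k = All.lookup x≢xs k∈xs
    in there k∈xs , trans (cong (x ∷_) rest≡) (≡.sym (List.filter-accept (_∉? [ k ]) (≢⇒∉[] (x≢k ∘ ≡.sym))))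

  splits-∖-unique : ∀ {U pre k post} → Unique U → (pre , k , post) ∈ splits U → Unique (pre ++ post)
  splits-∖-unique U! split∈ = subst Unique (≡.sym (proj₂ (splits-∖ U! split∈))) (Unique.filter⁺ _ U!)

  arrangements-sound : ∀ fuel {U s r} → Unique U → (s , r) ∈ arrangements fuel U →
                       Unique s × All (_∈ U) s × r ≡ U ∖ s
  arrangements-sound zero       {U} _ (here refl) = [] , [] , ≡.sym (∖-[] U)
  arrangements-sound (suc fuel) {U} _ (here refl) = [] , [] , ≡.sym (∖-[] U)
  arrangements-sound (suc fuel) {U} U! (there q∈)
    with ∈-concatMap-map⁻ prependPivot (arrangements fuel ∘ remainder) (splits U) q∈
  ... | (pre , k , post) , (s , r) , split∈ , q∈′ , refl =
    let k∈U , rest≡ = splits-∖ U! split∈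
        s! , s⊆rest , r≡ = arrangements-sound fuel (splits-∖-unique U! split∈) q∈′
        s⊆U∖k = All.map (subst (_ ∈_) rest≡) s⊆rest
    in All.map (λ x∈ k≡x → proj₂ (∈-∖⁻ U [ k ] x∈) (here (≡.sym k≡x))) s⊆U∖k ∷ s!
     , k∈U ∷ All.map (λ x∈ → proj₁ (∈-∖⁻ U [ k ] x∈)) s⊆U∖k
     , trans r≡ (trans (cong (_∖ s) rest≡) (∖-∷ U k s))

  arrangements-complete : ∀ fuel {U s} → Unique U → length U ≤ fuel → Unique s → All (_∈ U) s →
                          (s , U ∖ s) ∈ arrangements fuel U
  arrangements-complete zero       {U} {[]} _ _ _ _ = here (cong ([] ,_) (∖-[] U))
  arrangements-complete (suc fuel) {U} {[]} _ _ _ _ = here (cong ([] ,_) (∖-[] U))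
  arrangements-complete zero {[]} {k ∷ s} _ _ _ (() ∷ _)
  arrangements-complete (suc fuel) {U} {k ∷ s} U! |U|≤ (k≢s ∷ s!) (k∈U ∷ s⊆U) with ∈-∃++ k∈U
  ... | pre , post , refl =
    there (∈-concatMap-map⁺ prependPivot (arrangements fuel ∘ remainder) split∈
             (subst (λ r → (s , r) ∈ arrangements fuel (pre ++ post)) r≡
                    (arrangements-complete fuel (splits-∖-unique U! split∈) |rest|≤ s! s⊆rest)))
    where
    split∈ = splits-complete pre k post
    rest≡ = proj₂ (splits-∖ U! split∈)
    r≡ : (pre ++ post) ∖ s ≡ (pre ++ k ∷ post) ∖ (k ∷ s)
    r≡ = trans (cong (_∖ s) rest≡) (∖-∷ (pre ++ k ∷ post) k s)
    |rest|≤ : length (pre ++ post) ≤ fuel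
    |rest|≤ = ℕ.≤-pred (subst (_≤ suc fuel) (length-remove pre k post) |U|≤)
    s⊆rest : All (_∈ pre ++ post) s
    s⊆rest = All.zipWith (λ (x∈U , k≢x) → subst (_ ∈_) (≡.sym rest≡) (∈-∖⁺ x∈U (≢⇒∉[] k≢x))) (s⊆U , k≢s)

  arrangements-unique : ∀ fuel {U} → Unique U → AllPairs (_≢_ on proj₁) (arrangements fuel U)
  arrangements-unique zero       U! = [] ∷ []
  arrangements-unique (suc fuel) {U} U! =
    All.tabulate nonempty ∷ AllPairs-concatMap-map prependPivot (arrangements fuel ∘ remainder) (splits U) within across
    where
    nonempty : ∀ {q} → q ∈ concatMap _ (splits U) → [] ≢ proj₁ q
    nonempty q∈ with ∈-concatMap-map⁻ prependPivot (arrangements fuel ∘ remainder) (splits U) q∈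
    ... | _ , _ , _ , _ , refl = λ ()
    within = All.tabulate (λ {(pre , k , post)} split∈ →
               AllPairs.map (λ s≢s′ ks≡ks′ → s≢s′ (List.∷-injectiveʳ ks≡ks′))
                            (arrangements-unique fuel (splits-∖-unique U! split∈)))
    across = AllPairs.map (λ k≢k′ _ _ ks≡k′s′ → k≢k′ (List.∷-injectiveˡ ks≡k′s′))
                          (AllPairs.map⁻ (subst Unique (≡.sym (map-pivot-splits U)) U!))

-- Minors

module Minor {A : Set} (M : A → A → ℤ) where

  -- alt f [c₀, …, cₘ] = ∑ᵢ (-1)ⁱ f cᵢ (the cⱼ with j ≠ i)
  alt : (A → List A → ℤ) → List A → ℤ
  alt f []       = + 0
  alt f (c ∷ cs) = f c cs - alt (λ x ys → f x (c ∷ ys)) cs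

  -- the determinant of the submatrix of M on the given rows and columns (lists of equal length)
  minor : List A → List A → ℤ
  minor []       cs = + 1
  minor (r ∷ rs) cs = alt (λ c cs′ → M r c * minor rs cs′) cs

  alt-cong : ∀ {f g} cs → (∀ c cs′ → f c cs′ ≡ g c cs′) → alt f cs ≡ alt g cs
  alt-cong []       f≡g = refl
  alt-cong (c ∷ cs) f≡g = cong₂ _-_ (f≡g c cs) (alt-cong cs (λ x ys → f≡g x (c ∷ ys)))

  alt-*ˡ : ∀ s f cs → alt (λ c cs′ → s * f c cs′) cs ≡ s * alt f cs
  alt-*ˡ s f []       = ≡.sym (ℤ.*-zeroʳ s)
  alt-*ˡ s f (c ∷ cs) = trans (cong (λ z → s * f c cs - z) (alt-*ˡ s _ cs)) (distrib s (f c cs) _)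
    where
    distrib : ∀ s a b → s * a - s * b ≡ s * (a - b)
    distrib = solve-∀

  alt-− : ∀ f g cs → alt (λ c cs′ → f c cs′ - g c cs′) cs ≡ alt f cs - alt g cs
  alt-− f g []       = refl
  alt-− f g (c ∷ cs) = trans (cong (λ z → f c cs - g c cs - z) (alt-− _ _ cs)) (regroup (f c cs) _ _ _)
    where
    regroup : ∀ a b p q → (a - b) - (p - q) ≡ (a - p) - (b - q)
    regroup = solve-∀

  alt₂ : (A → A → List A → ℤ) → List A → ℤ
  alt₂ g = alt (λ c cs → alt (g c) cs)

  alt₂-antisym : ∀ g cs → alt₂ g cs ≡ - alt₂ (λ c c′ → g c′ c) cs
  alt₂-antisym g []       = refl
  alt₂-antisym g (x ∷ xs) = begin
      a - alt (λ c cs → g c x cs - alt (gₓ c) cs) xs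
    ≡⟨ cong (λ z → a - z) (alt-− _ _ xs) ⟩
      a - (b - alt₂ gₓ xs)
    ≡⟨ cong (λ z → a - (b - z)) (alt₂-antisym gₓ xs) ⟩
      a - (b - - alt₂ (λ c c′ → gₓ c′ c) xs)
    ≡⟨ rearrange a b _ ⟩
      - (b - (a - alt₂ (λ c c′ → gₓ c′ c) xs))
    ≡⟨ cong (λ z → - (b - z)) (alt-− _ _ xs) ⟨
      - (b - alt (λ c cs → g x c cs - alt (λ c′ → gₓ c′ c) cs) xs)
    ∎
    where
    open ≡-Reasoning
    gₓ = λ c c′ cs → g c c′ (x ∷ cs)
    a = alt (g x) xs
    b = alt (λ c → g c x) xs
    rearrange : ∀ a b z → a - (b - - z) ≡ - (b - (a - z))
    rearrange = solve-∀

  minor-swap : ∀ r r′ rs cs → minor (r ∷ r′ ∷ rs) cs ≡ - minor (r′ ∷ r ∷ rs) cs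
  minor-swap r r′ rs cs = begin
      alt (λ c cs′ → M r c * alt (λ c′ cs″ → M r′ c′ * minor rs cs″) cs′) cs
    ≡⟨ alt-cong cs (λ c cs′ → alt-*ˡ (M r c) _ cs′) ⟨
      alt₂ (λ c c′ cs″ → M r c * (M r′ c′ * minor rs cs″)) cs
    ≡⟨ alt₂-antisym _ cs ⟩
      - alt₂ (λ c c′ cs″ → M r c′ * (M r′ c * minor rs cs″)) cs
    ≡⟨ cong -_ (alt-cong cs (λ c cs′ → alt-cong cs′ (λ c′ cs″ → x∙yz≈y∙xz (M r c′) (M r′ c) _))) ⟩
      - alt₂ (λ c c′ cs″ → M r′ c * (M r c′ * minor rs cs″)) cs
    ≡⟨ cong -_ (alt-cong cs (λ c cs′ → alt-*ˡ (M r′ c) _ cs′)) ⟩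
      - alt (λ c cs′ → M r′ c * alt (λ c′ cs″ → M r c′ * minor rs cs″) cs′) cs
    ∎
    where open ≡-Reasoning

  minor-move-to-front : ∀ pre k post cs →
    minor (pre ++ k ∷ post) cs ≡ signℤ (length pre) * minor (k ∷ pre ++ post) cs
  minor-move-to-front []        k post cs = ≡.sym (ℤ.*-identityˡ _)
  minor-move-to-front (r ∷ pre) k post cs = begin
      alt (λ c cs′ → M r c * minor (pre ++ k ∷ post) cs′) cs
    ≡⟨ alt-cong cs (λ c cs′ → cong (M r c *_) (minor-move-to-front pre k post cs′)) ⟩
      alt (λ c cs′ → M r c * (s * minor (k ∷ pre ++ post) cs′)) cs
    ≡⟨ alt-cong cs (λ c cs′ → x∙yz≈y∙xz (M r c) s _) ⟩
      alt (λ c cs′ → s * (M r c * minor (k ∷ pre ++ post) cs′)) cs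
    ≡⟨ alt-*ˡ s _ cs ⟩
      s * minor (r ∷ k ∷ pre ++ post) cs
    ≡⟨ cong (s *_) (minor-swap r k (pre ++ post) cs) ⟩
      s * - minor (k ∷ r ∷ pre ++ post) cs
    ≡⟨ sign-step s _ ⟩
      signℤ (suc (length pre)) * minor (k ∷ r ∷ pre ++ post) cs
    ∎
    where
    open ≡-Reasoning
    s = signℤ (length pre)
    sign-step : ∀ s m → s * - m ≡ (- + 1 * s) * m
    sign-step = solve-∀

  alt≡∑splits : ∀ f cs →
    alt f cs ≡ ∑ (λ (pre , c , post) → signℤ (length pre) * f c (pre ++ post)) (splits cs)
  alt≡∑splits f []       = refl
  alt≡∑splits f (c ∷ cs) = begin
      f c cs - alt (λ x ys → f x (c ∷ ys)) cs
    ≡⟨ cong (λ z → f c cs - z) (alt≡∑splits _ cs) ⟩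
      f c cs - ∑ (λ (pre , k , post) → signℤ (length pre) * f k (c ∷ pre ++ post)) (splits cs)
    ≡⟨ cong₂ _+_ (≡.sym (ℤ.*-identityˡ (f c cs))) (≡.sym (∑-neg _ (splits cs))) ⟩
      + 1 * f c cs + ∑ (λ (pre , k , post) → - (signℤ (length pre) * f k (c ∷ pre ++ post))) (splits cs)
    ≡⟨ cong (λ z → + 1 * f c cs + z) (∑-cong (splits cs) (λ {(pre , _)} _ → ≡.sym (signℤ-suc (length pre) _))) ⟩
      + 1 * f c cs + ∑ (λ (pre , k , post) → signℤ (suc (length pre)) * f k (c ∷ pre ++ post)) (splits cs)
    ≡⟨ cong (λ z → + 1 * f c cs + z) (∑-map _ _ (splits cs)) ⟨
      ∑ (λ (pre , k , post) → signℤ (length pre) * f k (pre ++ post)) (splits (c ∷ cs))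
    ∎
    where open ≡-Reasoning

  minor-bordered-expansion : ∀ j t U →
    minor (j ∷ U) (t ∷ U) ≡
    M j t * minor U U - ∑ (λ (pre , k , post) → M j k * minor (k ∷ pre ++ post) (t ∷ pre ++ post)) (splits U)
  minor-bordered-expansion j t U =
    cong (λ z → M j t * minor U U - z) (trans (alt≡∑splits _ U) (∑-cong (splits U) (λ {(_ , _ , _)} → row-to-front)))
    where
    open ≡-Reasoning
    row-to-front : ∀ {pre k post} → (pre , k , post) ∈ splits U →
      signℤ (length pre) * (M j k * minor U (t ∷ pre ++ post)) ≡ M j k * minor (k ∷ pre ++ post) (t ∷ pre ++ post)
    row-to-front {pre} {k} {post} split∈ = begin
        s * (M j k * minor U cs)
      ≡⟨ cong (λ R → s * (M j k * minor R cs)) (splits-sound split∈) ⟩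
        s * (M j k * minor (pre ++ k ∷ post) cs)
      ≡⟨ cong (λ z → s * (M j k * z)) (minor-move-to-front pre k post cs) ⟩
        s * (M j k * (s * minor (k ∷ pre ++ post) cs))
      ≡⟨ regroup s (M j k) _ ⟩
        s * s * (M j k * minor (k ∷ pre ++ post) cs)
      ≡⟨ cong (_* (M j k * minor (k ∷ pre ++ post) cs)) (signℤ-sq (length pre)) ⟩
        + 1 * (M j k * minor (k ∷ pre ++ post) cs)
      ≡⟨ ℤ.*-identityˡ _ ⟩
        M j k * minor (k ∷ pre ++ post) cs
      ∎
      where
      s = signℤ (length pre)
      cs = t ∷ pre ++ post
      regroup : ∀ s m d → s * (m * (s * d)) ≡ s * s * (m * d)
      regroup = solve-∀

  pathWeight : A → List A → A → ℤ
  pathWeight j []      t = M j t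
  pathWeight j (k ∷ s) t = M j k * pathWeight k s t

  pathTerm : A → A → List A × List A → ℤ
  pathTerm j t (s , r) = signℤ (length s) * pathWeight j s t * minor r r

  minor-path-expansion : ∀ fuel j t U → length U ≤ fuel →
    minor (j ∷ U) (t ∷ U) ≡ ∑ (pathTerm j t) (arrangements fuel U)
  minor-path-expansion zero j t [] _ = last-row (M j t)
    where
    last-row : ∀ m → m * + 1 - + 0 ≡ + 1 * m * + 1 + + 0
    last-row = solve-∀
  minor-path-expansion (suc fuel) j t U |U|≤ = begin
      minor (j ∷ U) (t ∷ U)
    ≡⟨ minor-bordered-expansion j t U ⟩
      M j t * minor U U - ∑ (λ (pre , k , post) → M j k * minor (k ∷ pre ++ post) (t ∷ pre ++ post)) (splits U)
    ≡⟨ cong₂ _+_ (cong (_* minor U U) (≡.sym (ℤ.*-identityˡ (M j t))))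
                 (trans (≡.sym (∑-neg _ (splits U))) (∑-cong (splits U) (λ {(_ , _ , _)} → longer-paths))) ⟩
      pathTerm j t ([] , U) + ∑ (λ (pre , k , post) → ∑ (pathTerm j t) (extend k (pre ++ post))) (splits U)
    ≡⟨ cong (λ z → pathTerm j t ([] , U) + z) (∑-concatMap _ _ (splits U)) ⟨
      ∑ (pathTerm j t) (arrangements (suc fuel) U)
    ∎
    where
    open ≡-Reasoning
    extend : A → List A → List (List A × List A)
    extend k U′ = map (Product.map₁ (k ∷_)) (arrangements fuel U′)
    longer-paths : ∀ {pre k post} → (pre , k , post) ∈ splits U →
      - (M j k * minor (k ∷ pre ++ post) (t ∷ pre ++ post)) ≡ ∑ (pathTerm j t) (extend k (pre ++ post))
    longer-paths {pre} {k} {post} split∈ = begin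
        - (M j k * minor (k ∷ U′) (t ∷ U′))
      ≡⟨ cong (λ z → - (M j k * z)) (minor-path-expansion fuel k t U′ |U′|≤) ⟩
        - (M j k * ∑ (pathTerm k t) (arrangements fuel U′))
      ≡⟨ cong -_ (∑-*ˡ (M j k) (pathTerm k t) (arrangements fuel U′)) ⟨
        - ∑ (λ q → M j k * pathTerm k t q) (arrangements fuel U′)
      ≡⟨ ∑-neg (λ q → M j k * pathTerm k t q) (arrangements fuel U′) ⟨
        ∑ (λ q → - (M j k * pathTerm k t q)) (arrangements fuel U′)
      ≡⟨ ∑-cong (arrangements fuel U′) (λ {(s , r)} _ → prepend-step (length s) (M j k) (pathWeight k s t) (minor r r)) ⟩
        ∑ (λ (s , r) → pathTerm j t (k ∷ s , r)) (arrangements fuel U′)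
      ≡⟨ ∑-map (pathTerm j t) (Product.map₁ (k ∷_)) (arrangements fuel U′) ⟨
        ∑ (pathTerm j t) (extend k U′)
      ∎
      where
      U′ = pre ++ post
      |U′|≤ : length U′ ≤ fuel
      |U′|≤ = ℕ.≤-pred (subst (_≤ suc fuel) (trans (cong length (splits-sound split∈)) (length-remove pre k post)) |U|≤)
      prepend-step : ∀ ℓ m p d → - (m * (signℤ ℓ * p * d)) ≡ signℤ (suc ℓ) * (m * p) * d
      prepend-step ℓ = prepend-identity (signℤ ℓ)
        where
        prepend-identity : ∀ σ m p d → - (m * (σ * p * d)) ≡ (- + 1 * σ) * (m * p) * d
        prepend-identity = solve-∀

  alt-tabulate : ∀ m φ (g : Fin (suc m) → A) →
    alt φ (tabulate g) ≡ ∑[ j ∈ allFin (suc m) ] signℤ (toℕ j) * φ (g j) (tabulate (λ i → g (punchIn j i)))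
  alt-tabulate zero    φ g = single-column (φ (g Fin.zero) [])
    where
    single-column : ∀ a → a - + 0 ≡ + 1 * a + + 0
    single-column = solve-∀
  alt-tabulate (suc m) φ g = begin
      φ (g Fin.zero) cols - alt φ₀ cols
    ≡⟨ cong (λ z → φ (g Fin.zero) cols - z) (alt-tabulate m φ₀ (λ i → g (Fin.suc i))) ⟩
      φ (g Fin.zero) cols - ∑ h₀ (allFin (suc m))
    ≡⟨ cong₂ _+_ (≡.sym (ℤ.*-identityˡ (φ (g Fin.zero) cols))) (≡.sym (∑-neg h₀ (allFin (suc m)))) ⟩
      + 1 * φ (g Fin.zero) cols + ∑ (λ j → - h₀ j) (allFin (suc m))
    ≡⟨ cong (λ z → + 1 * φ (g Fin.zero) cols + z)
            (∑-cong (allFin (suc m)) (λ {j} _ → ≡.sym (signℤ-suc (toℕ j) (φ₁ j)))) ⟩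
      h Fin.zero + ∑ (λ j → h (Fin.suc j)) (allFin (suc m))
    ≡⟨ ∑-allFin-suc h ⟨
      ∑ h (allFin (suc (suc m)))
    ∎
    where
    open ≡-Reasoning
    cols = tabulate (λ i → g (Fin.suc i))
    φ₀ : A → List A → ℤ
    φ₀ x ys = φ x (g Fin.zero ∷ ys)
    φ₁ : Fin (suc m) → ℤ
    φ₁ j = φ₀ (g (Fin.suc j)) (tabulate (λ i → g (Fin.suc (punchIn j i))))
    h₀ : Fin (suc m) → ℤ
    h₀ j = signℤ (toℕ j) * φ₁ j
    h : Fin (suc (suc m)) → ℤ
    h j = signℤ (toℕ j) * φ (g j) (tabulate (λ i → g (punchIn j i)))

  det≡minor : ∀ m (f g : Fin m → A) → det m (λ i k → M (f i) (g k)) ≡ minor (tabulate f) (tabulate g)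
  det≡minor zero    f g = refl
  det≡minor (suc m) f g =
    trans (∑-cong (allFin (suc m)) (λ {j} _ →
             cong (λ z → signℤ (toℕ j) * (M (f Fin.zero) (g j) * z))
                  (det≡minor m (λ i → f (Fin.suc i)) (λ k → g (punchIn j k)))))
          (≡.sym (alt-tabulate m (λ c cs → M (f Fin.zero) c * minor (tabulate (λ i → f (Fin.suc i))) cs) g))

-- Orientations of cycles

module Orientation {n : ℕ} where

  open Arrangements (_≟_ {n})

  -- A cycle v → s₁ → ⋯ → sₘ → v is listed in exactly one of its two directions by requiring s₁ < sₘ.
  oriented : List (Fin n) → Bool
  oriented []           = false
  oriented (x ∷ [])     = true
  oriented (x ∷ y ∷ ys) = toℕ x ℕ.<ᵇ toℕ (lastOf y ys)

  orientedLong : List (Fin n) → Bool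
  orientedLong (x ∷ y ∷ ys) = oriented (x ∷ y ∷ ys)
  orientedLong _            = false

  orientations : List (Fin n) → ℤ
  orientations (_ ∷ _ ∷ _) = + 2
  orientations _           = + 1

  <ᵇ-flip : ∀ {x y : Fin n} → x ≢ y → (toℕ y ℕ.<ᵇ toℕ x) ≡ not (toℕ x ℕ.<ᵇ toℕ y)
  <ᵇ-flip {x} {y} x≢y with <-cmp x y
  ... | tri< x<y _ y≮x = trans (dec-false (y <? x) y≮x) (cong not (≡.sym (dec-true (x <? y) x<y)))
  ... | tri≈ _ x≡y _   = ⊥-elim (x≢y x≡y)
  ... | tri> x≮y _ y<x = trans (dec-true (y <? x) y<x) (cong not (≡.sym (dec-false (x <? y) x≮y)))

  orientedLong-∷ʳ : ∀ l w x → orientedLong (l ∷ w ∷ʳ x) ≡ (toℕ l ℕ.<ᵇ toℕ x)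
  orientedLong-∷ʳ l []       x = refl
  orientedLong-∷ʳ l (z ∷ zs) x = cong (λ m → toℕ l ℕ.<ᵇ toℕ m) (lastOf-∷ʳ z zs x)

  if-split : ∀ b (t : ℤ) → t ≡ (if b then t else + 0) + (if not b then t else + 0)
  if-split true  t = ≡.sym (ℤ.+-identityʳ t)
  if-split false t = ≡.sym (ℤ.+-identityˡ t)

  reversal-split : ∀ (F : List (Fin n) → ℤ) → F [] ≡ + 0 → (∀ s → F (reverse s) ≡ F s) → ∀ {s} → Unique s →
    F s ≡ (if oriented s then F s else + 0) + (if orientedLong (reverse s) then F (reverse s) else + 0)
  reversal-split F F[]≡0 F-reverse {[]}         _ = F[]≡0
  reversal-split F F[]≡0 F-reverse {x ∷ []}     _ = ≡.sym (ℤ.+-identityʳ _)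
  reversal-split F F[]≡0 F-reverse {s@(x ∷ y ∷ ys)} (x≢ys ∷ _) with reverse-∷ y ys
  ... | w , reverse≡ = begin
      F s
    ≡⟨ if-split (oriented s) (F s) ⟩
      (if oriented s then F s else + 0) + (if not (oriented s) then F s else + 0)
    ≡⟨ cong₂ (λ b t → (if oriented s then F s else + 0) + (if b then t else + 0))
             (≡.sym flipped) (≡.sym (F-reverse s)) ⟩
      (if oriented s then F s else + 0) + (if orientedLong (reverse s) then F (reverse s) else + 0)
    ∎
    where
    open ≡-Reasoning
    l = lastOf y ys
    flipped : orientedLong (reverse s) ≡ not (oriented s)
    flipped = trans (cong orientedLong (trans (List.unfold-reverse x (y ∷ ys)) (cong (_∷ʳ x) reverse≡)))
                    (trans (orientedLong-∷ʳ l w x) (<ᵇ-flip (All.lookup x≢ys (lastOf-∈ y ys))))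

  orientations-count : ∀ s (t : ℤ) →
    (if oriented s then t else + 0) + (if orientedLong s then t else + 0) ≡ (if oriented s then orientations s * t else + 0)
  orientations-count []           t = refl
  orientations-count (x ∷ [])     t = trans (ℤ.+-identityʳ t) (≡.sym (ℤ.*-identityˡ t))
  orientations-count (x ∷ y ∷ ys) t with oriented (x ∷ y ∷ ys)
  ... | true  = double t
    where
    double : ∀ t → t + t ≡ + 2 * t
    double = solve-∀
  ... | false = refl

  module _ (fuel : ℕ) {W : List (Fin n)} (W! : Unique W) (|W|≤ : length W ≤ fuel) where

    reverse₁ : List (Fin n) × List (Fin n) → List (Fin n) × List (Fin n)
    reverse₁ = Product.map₁ reverse

    arrangements-reverse : ∀ {q} → q ∈ arrangements fuel W → reverse₁ q ∈ arrangements fuel W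
    arrangements-reverse {s , r} q∈ with arrangements-sound fuel W! q∈
    ... | s! , s⊆W , r≡ =
      subst (λ r′ → (reverse s , r′) ∈ arrangements fuel W) (trans (∖-reverse W s) (≡.sym r≡))
            (arrangements-complete fuel W! |W|≤ (Unique-reverse s!)
                                   (All.tabulate (λ x∈ → All.lookup s⊆W (Any.reverse⁻ x∈))))

    arrangements-reverse-↭ : map reverse₁ (arrangements fuel W) ↭ arrangements fuel W
    arrangements-reverse-↭ = ↭-unique (Unique.map⁺ reverse₁-injective L!) L! (mk⇔ to from)
      where
      L = arrangements fuel W
      L! : Unique L
      L! = AllPairs.map (λ s≢s′ q≡q′ → s≢s′ (cong proj₁ q≡q′)) (arrangements-unique fuel W!)
      reverse₁-involutive : ∀ q → reverse₁ (reverse₁ q) ≡ q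
      reverse₁-involutive (s , r) = cong (_, r) (List.reverse-involutive s)
      reverse₁-injective : ∀ {q q′} → reverse₁ q ≡ reverse₁ q′ → q ≡ q′
      reverse₁-injective {q} {q′} eq =
        trans (≡.sym (reverse₁-involutive q)) (trans (cong reverse₁ eq) (reverse₁-involutive q′))
      to : ∀ {q} → q ∈ map reverse₁ L → q ∈ L
      to q∈ = let q′ , q′∈ , q≡ = ∈-map⁻ reverse₁ q∈ in subst (_∈ L) (≡.sym q≡) (arrangements-reverse q′∈)
      from : ∀ {q} → q ∈ L → q ∈ map reverse₁ L
      from {q} q∈ = subst (_∈ map reverse₁ L) (reverse₁-involutive q) (∈-map⁺ reverse₁ (arrangements-reverse q∈))

    ∑-arrangements-reversal : ∀ (F : List (Fin n) × List (Fin n) → ℤ) →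
      (∀ r → F ([] , r) ≡ + 0) → (∀ s r → F (reverse s , r) ≡ F (s , r)) →
      ∑ F (arrangements fuel W) ≡
      ∑ (λ q → orientations (proj₁ q) * F q) (filter (T? ∘ oriented ∘ proj₁) (arrangements fuel W))
    ∑-arrangements-reversal F F[]≡0 F-reverse = begin
        ∑ F L
      ≡⟨ ∑-cong L (λ {(s , r)} q∈ → reversal-split (λ s → F (s , r)) (F[]≡0 r) (λ s → F-reverse s r)
                                                   (proj₁ (arrangements-sound fuel W! q∈))) ⟩
        ∑ (λ q → forward q + backward (reverse₁ q)) L
      ≡⟨ ∑-+ forward (backward ∘ reverse₁) L ⟩
        ∑ forward L + ∑ (backward ∘ reverse₁) L
      ≡⟨ cong (λ z → ∑ forward L + z) (∑-map backward reverse₁ L) ⟨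
        ∑ forward L + ∑ backward (map reverse₁ L)
      ≡⟨ cong (λ z → ∑ forward L + z) (∑-↭ backward arrangements-reverse-↭) ⟩
        ∑ forward L + ∑ backward L
      ≡⟨ ∑-+ forward backward L ⟨
        ∑ (λ q → forward q + backward q) L
      ≡⟨ ∑-cong L (λ {(s , r)} _ → orientations-count s (F (s , r))) ⟩
        ∑ (λ q → if oriented (proj₁ q) then orientations (proj₁ q) * F q else + 0) L
      ≡⟨ ∑-filter (T? ∘ oriented ∘ proj₁) (λ q → orientations (proj₁ q) * F q) L ⟨
        ∑ (λ q → orientations (proj₁ q) * F q) (filter (T? ∘ oriented ∘ proj₁) L)
      ∎
      where
      open ≡-Reasoning
      L = arrangements fuel W
      forward backward : List (Fin n) × List (Fin n) → ℤ
      forward  (s , r) = if oriented s then F (s , r) else + 0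
      backward (s , r) = if orientedLong s then F (s , r) else + 0

-- Cycle partitions

module CyclePartitions {n : ℕ} where

  open Arrangements (_≟_ {n})
  open Orientation {n}

  orientedArrangements : ℕ → List (Fin n) → List (List (Fin n) × List (Fin n))
  orientedArrangements fuel W = filter (T? ∘ oriented ∘ proj₁) (arrangements fuel W)

  oriented-remainder : ∀ fuel {W q} → Unique W → q ∈ orientedArrangements fuel W →
                       Unique (proj₂ q) × length (proj₂ q) ≤ length W
  oriented-remainder fuel {W} {s , r} W! q∈
    with arrangements-sound fuel W! (proj₁ (∈-filter⁻ (T? ∘ oriented ∘ proj₁) q∈))
  ... | _ , _ , refl = Unique.filter⁺ _ W! , length-∖ W s

  prependCycle : Fin n → List (Fin n) × List (Fin n) → List (List (Fin n)) → List (List (Fin n))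
  prependCycle v (s , _) S = (v ∷ s) ∷ S

  -- For length V ≤ fuel: the partitions of V into cycles of length ≥ 2 in the canonical form of Defs.
  cyclePartitions : ℕ → List (Fin n) → List (List (List (Fin n)))
  cyclePartitions zero       _       = [ [] ]
  cyclePartitions (suc fuel) []      = [ [] ]
  cyclePartitions (suc fuel) (v ∷ W) =
    concatMap (λ q → map (prependCycle v q) (cyclePartitions fuel (proj₂ q))) (orientedArrangements fuel W)

  CanonicalCycle : List (Fin n) → Set
  CanonicalCycle P = Canonical P × Unique P

  CyclePartition : List (Fin n) → List (List (Fin n)) → Set
  CyclePartition V S = All CanonicalCycle S × Linked HeadLt S × concat S ↭ V

  canonical⁺ : ∀ {v : Fin n} {s} → All (v <_) s → T (oriented s) → Canonical (v ∷ s)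
  canonical⁺ {s = x ∷ []}     (v<x ∷ []) _        = pair v<x
  canonical⁺ {s = x ∷ y ∷ ys} v<s        x<l      = cycle v<s (ℕ.<ᵇ⇒< _ _ x<l)

  canonical-oriented : ∀ {v : Fin n} {s} → Canonical (v ∷ s) → T (oriented s)
  canonical-oriented (pair _)      = tt
  canonical-oriented (cycle _ x<l) = ℕ.<⇒<ᵇ x<l

  canonical-least : ∀ {v : Fin n} {s} → Canonical (v ∷ s) → All (v <_) s
  canonical-least (pair v<x)    = v<x ∷ []
  canonical-least (cycle v<s _) = v<s

  head-least : ∀ {u : Fin n} {s S} → All CanonicalCycle ((u ∷ s) ∷ S) → Linked HeadLt ((u ∷ s) ∷ S) →
               All (u Fin.≤_) (concat ((u ∷ s) ∷ S))
  head-least {S = []}             ((c , _) ∷ _) _ =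
    All.++⁺ (ℕ.≤-refl ∷ All.map ℕ.<⇒≤ (canonical-least c)) []
  head-least {S = (u′ ∷ s′) ∷ S′} ((c , _) ∷ parts) (headLt u<u′ ∷ linked) =
    All.++⁺ (ℕ.≤-refl ∷ All.map ℕ.<⇒≤ (canonical-least c))
            (All.map (ℕ.≤-trans (ℕ.<⇒≤ u<u′)) (head-least parts linked))
  head-least {S = [] ∷ _}         (_ ∷ ((() , _) ∷ _)) _

  linked-∷ : ∀ {v : Fin n} {s S} → All (v <_) (concat S) → All CanonicalCycle S → Linked HeadLt S →
             Linked HeadLt ((v ∷ s) ∷ S)
  linked-∷ {S = []}          _         _             _      = [-]
  linked-∷ {S = (u ∷ _) ∷ _} (v<u ∷ _) _             linked = headLt v<u ∷ linked
  linked-∷ {S = [] ∷ _}      _         ((() , _) ∷ _) _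

  cyclePartitions-sound : ∀ fuel {V S} → AllPairs _<_ V → length V ≤ fuel →
                          S ∈ cyclePartitions fuel V → CyclePartition V S
  cyclePartitions-sound zero       {[]}    _ _ (here refl) = [] , [] , ↭-refl
  cyclePartitions-sound (suc fuel) {[]}    _ _ (here refl) = [] , [] , ↭-refl
  cyclePartitions-sound (suc fuel) {v ∷ W} (v<W ∷ W<) (ℕ.s≤s |W|≤) S∈
    with ∈-concatMap-map⁻ (prependCycle v) (cyclePartitions fuel ∘ proj₂) (orientedArrangements fuel W) S∈
  ... | (s , r) , S′ , q∈ , S′∈ , refl with ∈-filter⁻ (T? ∘ oriented ∘ proj₁) q∈
  ... | q∈A , s-oriented with arrangements-sound fuel (AllPairs.map <⇒≢ W<) q∈A
  ... | s! , s⊆W , refl with cyclePartitions-sound fuel (AllPairs.filter⁺ _ W<) (ℕ.≤-trans (length-∖ W s) |W|≤) S′∈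
  ... | parts , linked , S′↭ =
    (canonical⁺ v<s s-oriented , All.map <⇒≢ v<s ∷ s!) ∷ parts ,
    linked-∷ v<S′ parts linked ,
    ↭-prep v (↭-trans (↭.++⁺ˡ s S′↭) (++-∖-↭ W! s! s⊆W))
    where
    W! = AllPairs.map <⇒≢ W<
    v<s = All.map (All.lookup v<W) s⊆W
    v<S′ = All.tabulate (λ x∈ → All.lookup v<W (proj₁ (∈-∖⁻ W s (↭.∈-resp-↭ S′↭ x∈))))
  cyclePartitions-sound zero {_ ∷ _} _ () _

  cyclePartitions-unique : ∀ fuel {V} → Unique V → Unique (cyclePartitions fuel V)
  cyclePartitions-unique zero       _ = [] ∷ []
  cyclePartitions-unique (suc fuel) {[]} _ = [] ∷ []
  cyclePartitions-unique (suc fuel) {v ∷ W} (_ ∷ W!) =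
    AllPairs-concatMap-map (prependCycle v) (cyclePartitions fuel ∘ proj₂) (orientedArrangements fuel W)
                           within across
    where
    within = All.tabulate (λ q∈ → AllPairs.map (λ S≢S′ eq → S≢S′ (List.∷-injectiveʳ eq))
                                               (cyclePartitions-unique fuel (proj₁ (oriented-remainder fuel W! q∈))))
    across = AllPairs.map (λ s≢s′ _ _ eq → s≢s′ (List.∷-injectiveʳ (List.∷-injectiveˡ eq)))
                          (AllPairs.filter⁺ _ (arrangements-unique fuel W!))

  cyclePartition-[] : ∀ {S} → CyclePartition [] S → S ≡ []
  cyclePartition-[] {[]}          _                  = refl
  cyclePartition-[] {(u ∷ P) ∷ S} (_ , _ , S↭[]) with () ← ↭.↭-empty-inv S↭[]
  cyclePartition-[] {[] ∷ S}      (((() , _) ∷ _) , _)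

  first-part-least : ∀ {v : Fin n} {W u s S} → All (v <_) W → CyclePartition (v ∷ W) ((u ∷ s) ∷ S) → u ≡ v
  first-part-least v<W (parts , linked , S↭) with ↭.∈-resp-↭ S↭ (here refl)
  ... | here u≡v  = u≡v
  ... | there u∈W =
    ⊥-elim (ℕ.<⇒≱ (All.lookup v<W u∈W)
                  (All.lookup (head-least parts linked) (↭.∈-resp-↭ (↭-sym S↭) (here refl))))

  cyclePartition-rest : ∀ {v : Fin n} {W s S} → AllPairs _<_ (v ∷ W) → CyclePartition (v ∷ W) ((v ∷ s) ∷ S) →
                        All (_∈ W) s × CyclePartition (W ∖ s) S
  cyclePartition-rest {v} {W} {s} {S} (v<W ∷ W<) ((_ , v≢s ∷ _) ∷ parts , linked , S↭) =
    s⊆W , parts , Linked.tail linked , ↭-unique S! (Unique.filter⁺ _ W!) (mk⇔ to from)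
    where
    W! = AllPairs.map <⇒≢ W<
    split = Unique-++⁻ (v ∷ s) (Unique-resp-↭ (≡.setoid (Fin n)) (↭⇒↭ₛ (↭-sym S↭))
                                              (All.map <⇒≢ v<W ∷ W!))
    S! = proj₁ split
    disjoint : ∀ {x} → x ∈ v ∷ s → x ∉ concat S
    disjoint = proj₂ split
    s⊆W = All.tabulate (λ x∈s → Any.tail (λ x≡v → All.lookup v≢s x∈s (≡.sym x≡v))
                                         (↭.∈-resp-↭ S↭ (∈-++⁺ˡ (there x∈s))))
    to : ∀ {x} → x ∈ concat S → x ∈ W ∖ s
    to x∈ = ∈-∖⁺ (Any.tail (λ x≡v → disjoint (here x≡v) x∈) (↭.∈-resp-↭ S↭ (∈-++⁺ʳ (v ∷ s) x∈)))
                 (λ x∈s → disjoint (there x∈s) x∈)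
    from : ∀ {x} → x ∈ W ∖ s → x ∈ concat S
    from {x} x∈ with ∈-∖⁻ W s x∈
    ... | x∈W , x∉s with ∈-++⁻ (v ∷ s) (↭.∈-resp-↭ (↭-sym S↭) (there x∈W))
    ...   | inj₁ (here refl)  = ⊥-elim (ℕ.<-irrefl refl (All.lookup v<W x∈W))
    ...   | inj₁ (there x∈s) = ⊥-elim (x∉s x∈s)
    ...   | inj₂ x∈S         = x∈S

  cyclePartitions-complete : ∀ fuel {V S} → AllPairs _<_ V → length V ≤ fuel →
                             CyclePartition V S → S ∈ cyclePartitions fuel V
  cyclePartitions-complete zero       {[]} _ _ S-part with refl ← cyclePartition-[] S-part = here refl
  cyclePartitions-complete (suc fuel) {[]} _ _ S-part with refl ← cyclePartition-[] S-part = here refl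
  cyclePartitions-complete zero {_ ∷ _} _ () _
  cyclePartitions-complete (suc fuel) {v ∷ W} {[]} _ _ (_ , _ , []↭) with () ← ↭.↭-empty-inv (↭-sym []↭)
  cyclePartitions-complete (suc fuel) {v ∷ W} {[] ∷ S} _ _ (((() , _) ∷ _) , _)
  cyclePartitions-complete (suc fuel) {v ∷ W} {(u ∷ s) ∷ S} V< (ℕ.s≤s |W|≤) S-part@((c , s!) ∷ _ , _)
    with refl ← first-part-least (AllPairs.head V<) S-part =
    ∈-concatMap-map⁺ (prependCycle v) (cyclePartitions fuel ∘ proj₂) q∈
      (cyclePartitions-complete fuel (AllPairs.filter⁺ _ W<) (ℕ.≤-trans (length-∖ W s) |W|≤) S-rest)
    where
    W< = AllPairs.tail V<
    s⊆W = proj₁ (cyclePartition-rest V< S-part)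
    S-rest = proj₂ (cyclePartition-rest V< S-part)
    q∈ = ∈-filter⁺ (T? ∘ oriented ∘ proj₁)
                   (arrangements-complete fuel (AllPairs.map <⇒≢ W<) |W|≤ (AllPairs.tail s!) s⊆W)
                   (canonical-oriented c)

-- Cycle expansion of symmetric matrices with zero diagonal

module CycleExpansion {n : ℕ} (M : Fin n → Fin n → ℤ)
                      (M-sym : ∀ u v → M u v ≡ M v u) (M-diag : ∀ u → M u u ≡ + 0) where

  open Minor M
  open Arrangements (_≟_ {n})
  open Orientation {n}
  open CyclePartitions {n}

  pairsProduct : List (Fin n × Fin n) → ℤ
  pairsProduct []             = + 1
  pairsProduct ((u , v) ∷ es) = M u v * pairsProduct es

  partWeight : List (Fin n) → ℤ
  partWeight []      = + 1
  partWeight (v ∷ s) = orientations s * (signℤ (length s) * pairsProduct (cyclePairs (v ∷ s)))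

  partitionWeight : List (List (Fin n)) → ℤ
  partitionWeight []      = + 1
  partitionWeight (P ∷ S) = partWeight P * partitionWeight S

  pathWeight-closed : ∀ v s → pathWeight v s v ≡ pairsProduct (cyclePairs (v ∷ s))
  pathWeight-closed v []       = ≡.sym (ℤ.*-identityʳ (M v v))
  pathWeight-closed v (y ∷ ys) = cong (M v y *_) (onwards y ys)
    where
    onwards : ∀ y ys → pathWeight y ys v ≡ pairsProduct (drop 1 (cyclePairs (v ∷ y ∷ ys)))
    onwards y []       = ≡.sym (ℤ.*-identityʳ (M y v))
    onwards y (z ∷ zs) = cong (M y z *_) (onwards z zs)

  pathWeight-∷ʳ : ∀ j s k t → pathWeight j (s ∷ʳ k) t ≡ pathWeight j s k * M k t
  pathWeight-∷ʳ j []      k t = refl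
  pathWeight-∷ʳ j (x ∷ s) k t =
    trans (cong (M j x *_) (pathWeight-∷ʳ x s k t)) (≡.sym (ℤ.*-assoc (M j x) _ _))

  pathWeight-reverse : ∀ s j t → pathWeight j (reverse s) t ≡ pathWeight t s j
  pathWeight-reverse []      j t = M-sym j t
  pathWeight-reverse (k ∷ s) j t = begin
      pathWeight j (reverse (k ∷ s)) t   ≡⟨ cong (λ s′ → pathWeight j s′ t) (List.unfold-reverse k s) ⟩
      pathWeight j (reverse s ∷ʳ k) t    ≡⟨ pathWeight-∷ʳ j (reverse s) k t ⟩
      pathWeight j (reverse s) k * M k t ≡⟨ cong₂ _*_ (pathWeight-reverse s j k) (M-sym k t) ⟩
      pathWeight k s j * M t k           ≡⟨ ℤ.*-comm _ (M t k) ⟩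
      M t k * pathWeight k s j           ∎
    where open ≡-Reasoning

  minor≡∑cyclePartitions : ∀ fuel {V} → Unique V → length V ≤ fuel →
                           minor V V ≡ ∑ partitionWeight (cyclePartitions fuel V)
  minor≡∑cyclePartitions zero       {[]} _ _ = refl
  minor≡∑cyclePartitions (suc fuel) {[]} _ _ = refl
  minor≡∑cyclePartitions (suc fuel) {v ∷ W} (_ ∷ W!) (ℕ.s≤s |W|≤) = begin
      minor (v ∷ W) (v ∷ W)
    ≡⟨ minor-path-expansion fuel v v W |W|≤ ⟩
      ∑ (pathTerm v v) (arrangements fuel W)
    ≡⟨ ∑-arrangements-reversal fuel W! |W|≤ (pathTerm v v) no-loop reverse-invariant ⟩
      ∑ (λ q → orientations (proj₁ q) * pathTerm v v q) (orientedArrangements fuel W)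
    ≡⟨ ∑-cong (orientedArrangements fuel W) first-cycle ⟩
      ∑ (λ q → ∑ partitionWeight (map (prependCycle v q) (cyclePartitions fuel (proj₂ q)))) (orientedArrangements fuel W)
    ≡⟨ ∑-concatMap partitionWeight _ (orientedArrangements fuel W) ⟨
      ∑ partitionWeight (cyclePartitions (suc fuel) (v ∷ W))
    ∎
    where
    open ≡-Reasoning
    no-loop : ∀ r → pathTerm v v ([] , r) ≡ + 0
    no-loop r = trans (cong (λ m → + 1 * m * minor r r) (M-diag v)) (ℤ.*-zeroˡ (minor r r))
    reverse-invariant : ∀ s r → pathTerm v v (reverse s , r) ≡ pathTerm v v (s , r)
    reverse-invariant s r =
      cong₂ (λ ℓ p → signℤ ℓ * p * minor r r) (List.length-reverse s) (pathWeight-reverse s v v)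
    first-cycle : ∀ {q} → q ∈ orientedArrangements fuel W →
      orientations (proj₁ q) * pathTerm v v q ≡ ∑ partitionWeight (map (prependCycle v q) (cyclePartitions fuel (proj₂ q)))
    first-cycle {s , r} q∈ = begin
        orientations s * (signℤ (length s) * pathWeight v s v * minor r r)
      ≡⟨ cong (λ p → orientations s * (signℤ (length s) * p * minor r r)) (pathWeight-closed v s) ⟩
        orientations s * (signℤ (length s) * pairsProduct (cyclePairs (v ∷ s)) * minor r r)
      ≡⟨ regroup (orientations s) (signℤ (length s)) (pairsProduct (cyclePairs (v ∷ s))) (minor r r) ⟩
        partWeight (v ∷ s) * minor r r
      ≡⟨ cong (partWeight (v ∷ s) *_) (minor≡∑cyclePartitions fuel r! |r|≤) ⟩
        partWeight (v ∷ s) * ∑ partitionWeight (cyclePartitions fuel r)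
      ≡⟨ ∑-*ˡ (partWeight (v ∷ s)) partitionWeight (cyclePartitions fuel r) ⟨
        ∑ (λ S → partitionWeight ((v ∷ s) ∷ S)) (cyclePartitions fuel r)
      ≡⟨ ∑-map partitionWeight ((v ∷ s) ∷_) (cyclePartitions fuel r) ⟨
        ∑ partitionWeight (map ((v ∷ s) ∷_) (cyclePartitions fuel r))
      ∎
      where
      regroup : ∀ o σ p d → o * (σ * p * d) ≡ o * (σ * p) * d
      regroup = solve-∀
      r! = proj₁ (oriented-remainder fuel W! q∈)
      |r|≤ = ℕ.≤-trans (proj₂ (oriented-remainder fuel W! q∈)) |W|≤

-- Distances in a graph

≡ᵇ-sound : ∀ {m n} → (m ≡ᵇ n) ≡ true → m ≡ n
≡ᵇ-sound {m} {n} m≡ᵇn = ℕ.≡ᵇ⇒≡ m n (Equivalence.from Bool.T-≡ m≡ᵇn)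

T-ext : ∀ {a b} → (T a → T b) → (T b → T a) → a ≡ b
T-ext {false} {false} _ _ = refl
T-ext {false} {true}  _ b⇒a with () ← b⇒a tt
T-ext {true}  {false} a⇒b _ with () ← a⇒b tt
T-ext {true}  {true}  _ _ = refl

module Distances {n : ℕ} (G : Graph n) where

  -- Wrapping T (reach G k u v) in a record lets Agda infer k, u and v.
  record Reach (k : ℕ) (u v : Fin n) : Set where
    constructor reached
    field holds : T (reach G k u v)
  open Reach

  reach-refl : ∀ u → Reach 0 u u
  reach-refl u = reached (fromWitness refl)

  reach-zero : ∀ {u v} → Reach 0 u v → u ≡ v
  reach-zero (reached r) = toWitness r

  reach-suc : ∀ {k u v} → Reach k u v → Reach (suc k) u v
  reach-suc (reached r) = reached (Equivalence.from Bool.T-∨ (inj₁ r))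

  reach-step : ∀ {k u w v} → Reach k u w → T (adj G w v) → Reach (suc k) u v
  reach-step {w = w} (reached r) w~v =
    reached (Equivalence.from Bool.T-∨ (inj₂ (Any.any⁺ _ (lose (∈-allFin w) (Equivalence.from Bool.T-∧ (r , w~v))))))

  reach-last : ∀ {k u v} → Reach (suc k) u v → Reach k u v ⊎ ∃ λ w → Reach k u w × T (adj G w v)
  reach-last {k} {u} {v} (reached r) with Equivalence.to (Bool.T-∨ {reach G k u v}) r
  ... | inj₁ r′ = inj₁ (reached r′)
  ... | inj₂ r′ with find (Any.any⁻ _ (allFin n) r′)
  ...   | w , _ , r∧w~v with Equivalence.to (Bool.T-∧ {reach G k u w}) r∧w~v
  ...     | r″ , w~v = inj₂ (w , reached r″ , w~v)

  reach-first : ∀ k {v w u} → T (adj G v w) → Reach k w u → Reach (suc k) v u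
  reach-first zero    v~w r = subst (Reach 1 _) (reach-zero r) (reach-step (reach-refl _) v~w)
  reach-first (suc k) v~w r with reach-last r
  ... | inj₁ r′            = reach-suc (reach-first k v~w r′)
  ... | inj₂ (x , r′ , x~u) = reach-step (reach-first k v~w r′) x~u

  reach-sym : ∀ k {u v} → Reach k u v → Reach k v u
  reach-sym zero    r = subst (λ x → Reach 0 x _) (reach-zero r) (reach-refl _)
  reach-sym (suc k) r with reach-last r
  ... | inj₁ r′            = reach-suc (reach-sym k r′)
  ... | inj₂ (w , r′ , w~v) = reach-first k (subst T (Graph.sym G _ _) w~v) (reach-sym k r′)

  least-cong : ∀ {p q : ℕ → Bool} b → (∀ k → p k ≡ q k) → least G p b ≡ least G q b
  least-cong         zero    p≗q = refl
  least-cong {p} {q} (suc b) p≗q =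
    cong₂ (λ c l → if c then zero else suc l) (p≗q 0) (least-cong b (λ k → p≗q (suc k)))

  dist-sym : ∀ u v → dist G u v ≡ dist G v u
  dist-sym u v = least-cong n (λ k → T-ext (reach-sym′ k) (reach-sym′ k))
    where
    reach-sym′ : ∀ k {u v} → T (reach G k u v) → T (reach G k v u)
    reach-sym′ k r = holds (reach-sym k (reached r))

  ⌊≟⌋-sym : ∀ (u v : Fin n) → ⌊ u ≟ v ⌋ ≡ ⌊ v ≟ u ⌋
  ⌊≟⌋-sym u v = T-ext (fromWitness ∘ ≡.sym ∘ toWitness) (fromWitness ∘ ≡.sym ∘ toWitness)

  isAntipodal-sym : ∀ u v → isAntipodal G u v ≡ isAntipodal G v u
  isAntipodal-sym u v = cong₂ (λ b k → not b ∧ (k ≡ᵇ diam G)) (⌊≟⌋-sym u v) (dist-sym u v)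

  AD-sym : ∀ u v → AD G u v ≡ AD G v u
  AD-sym u v = cong (λ k → if k ≡ᵇ 1 then + 1 else (if k ≡ᵇ diam G then + diam G else + 0)) (dist-sym u v)

  least-zero : ∀ (p : ℕ → Bool) b → p 0 ≡ true → least G p b ≡ 0
  least-zero p zero    _    = refl
  least-zero p (suc b) p0≡ rewrite p0≡ = refl

  least-one : ∀ (p : ℕ → Bool) b → p 0 ≡ false → (least G p (suc (suc b)) ≡ᵇ 1) ≡ p 1
  least-one p b p0≡ rewrite p0≡ with p 1
  ... | true  = refl
  ... | false = refl

  dist-self : ∀ u → dist G u u ≡ 0
  dist-self u = least-zero (λ k → reach G k u u) n (Equivalence.to Bool.T-≡ (holds (reach-refl u)))

  reach-one : ∀ {u v} → u ≢ v → reach G 1 u v ≡ adj G u v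
  reach-one {u} {v} u≢v =
    T-ext (λ r → first-step (reach-last (reached r))) (λ u~v → holds (reach-step (reach-refl u) u~v))
    where
    first-step : Reach 0 u v ⊎ ∃ (λ w → Reach 0 u w × T (adj G w v)) → T (adj G u v)
    first-step (inj₁ r)             = ⊥-elim (u≢v (reach-zero r))
    first-step (inj₂ (w , r , w~v)) = subst (λ x → T (adj G x v)) (≡.sym (reach-zero r)) w~v

  two-vertices : ∀ {m} {u v : Fin m} → u ≢ v → ∃ λ b → m ≡ suc (suc b)
  two-vertices {u = Fin.zero}          {Fin.zero}          u≢v = ⊥-elim (u≢v refl)
  two-vertices {u = Fin.zero}          {Fin.suc {suc b} _} _   = b , refl
  two-vertices {u = Fin.suc {suc b} _}                     _   = b , refl

  adj≡dist≡ᵇ1 : ∀ {u v} → u ≢ v → adj G u v ≡ (dist G u v ≡ᵇ 1)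
  adj≡dist≡ᵇ1 {u} {v} u≢v with two-vertices u≢v
  ... | b , n≡ = ≡.sym (begin
      (least G p n ≡ᵇ 1)            ≡⟨ cong (λ m → least G p m ≡ᵇ 1) n≡ ⟩
      (least G p (suc (suc b)) ≡ᵇ 1) ≡⟨ least-one p b (Equivalence.to Bool.T-not-≡ (fromWitnessFalse u≢v)) ⟩
      reach G 1 u v                 ≡⟨ reach-one u≢v ⟩
      adj G u v                     ∎)
    where
    open ≡-Reasoning
    p = λ k → reach G k u v

  AD-diag : ∀ u → AD G u u ≡ + 0
  AD-diag u rewrite dist-self u = off-diameter (diam G)
    where
    off-diameter : ∀ d → (if 0 ≡ᵇ d then + d else + 0) ≡ + 0
    off-diameter zero    = refl
    off-diameter (suc d) = refl

  AD-entry : ∀ u v → AD G u v ≡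
    (if isAdj G u v ∨ isAntipodal G u v then + (diam G ^ (if isAntipodal G u v then 1 else 0)) else + 0)
  AD-entry u v with u ≟ v
  ... | yes refl rewrite AD-diag u | Graph.irrefl G u = refl
  ... | no u≢v rewrite adj≡dist≡ᵇ1 u≢v = by-distance (dist G u v) (diam G)
    where
    by-distance : ∀ k d → (if k ≡ᵇ 1 then + 1 else (if k ≡ᵇ d then + d else + 0)) ≡
                          (if (k ≡ᵇ 1) ∨ (k ≡ᵇ d) then + (d ^ (if k ≡ᵇ d then 1 else 0)) else + 0)
    by-distance k d with k ≡ᵇ 1 in k≡1 | k ≡ᵇ d in k≡d
    ... | true  | true  = cong (λ x → + (x ^ 1)) (trans (≡.sym (≡ᵇ-sound {k} {1} k≡1)) (≡ᵇ-sound {k} {d} k≡d))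
    ... | true  | false = refl
    ... | false | true  = cong +_ (≡.sym (ℕ.*-identityʳ d))
    ... | false | false = refl

  AD-adjOrAntipodal : ∀ u v → T (isAdj G u v ∨ isAntipodal G u v) →
                      AD G u v ≡ + (diam G ^ (if isAntipodal G u v then 1 else 0))
  AD-adjOrAntipodal u v u~v with isAdj G u v ∨ isAntipodal G u v | AD-entry u v
  ... | true | AD≡ = AD≡

  AD-neither : ∀ u v → ¬ T (isAdj G u v ∨ isAntipodal G u v) → AD G u v ≡ + 0
  AD-neither u v ¬u~v with isAdj G u v ∨ isAntipodal G u v | AD-entry u v
  ... | true  | _   = ⊥-elim (¬u~v tt)
  ... | false | AD≡ = AD≡

-- Weights of adjacency-diametrical partitions

module AdjacencyDiametrical {n : ℕ} (G : Graph n) where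

  open Distances G
  open CycleExpansion (AD G) AD-sym AD-diag
  open CyclePartitions {n}
  open Orientation {n} using (orientations)

  antipodal : Fin n × Fin n → Bool
  antipodal (u , v) = isAntipodal G u v

  EdgesValid : List (Fin n) → Set
  EdgesValid P = All (AdjOrAntipodal G) (cyclePairs P)

  edgesValid? : Decidable EdgesValid
  edgesValid? P = All.all? (λ (u , v) → T? (isAdj G u v ∨ isAntipodal G u v)) (cyclePairs P)

  pairsProduct-valid : ∀ es → All (AdjOrAntipodal G) es → pairsProduct es ≡ + (diam G ^ count G antipodal es)
  pairsProduct-valid []             []            = refl
  pairsProduct-valid ((u , v) ∷ es) (u~v ∷ valid) = begin
      AD G u v * pairsProduct es
    ≡⟨ cong₂ _*_ (AD-adjOrAntipodal u v u~v) (pairsProduct-valid es valid) ⟩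
      + (diam G ^ (if isAntipodal G u v then 1 else 0)) * + (diam G ^ count G antipodal es)
    ≡⟨ power-step (isAntipodal G u v) _ ⟩
      + (diam G ^ count G antipodal ((u , v) ∷ es))
    ∎
    where
    open ≡-Reasoning
    power-step : ∀ b c → + (diam G ^ (if b then 1 else 0)) * + (diam G ^ c) ≡
                         + (diam G ^ (if b then suc c else c))
    power-step true  c =
      trans (≡.sym (ℤ.pos-* (diam G ^ 1) (diam G ^ c))) (cong +_ (≡.sym (ℕ.^-distribˡ-+-* (diam G) 1 c)))
    power-step false c = ℤ.*-identityˡ _

  pairsProduct-invalid : ∀ es → ¬ All (AdjOrAntipodal G) es → pairsProduct es ≡ + 0
  pairsProduct-invalid []             invalid = ⊥-elim (invalid [])
  pairsProduct-invalid ((u , v) ∷ es) invalid with T? (isAdj G u v ∨ isAntipodal G u v)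
  ... | yes u~v = trans (cong (AD G u v *_) (pairsProduct-invalid es (λ valid → invalid (u~v ∷ valid))))
                        (ℤ.*-zeroʳ (AD G u v))
  ... | no ¬u~v = trans (cong (_* pairsProduct es) (AD-neither u v ¬u~v)) (ℤ.*-zeroˡ (pairsProduct es))

  weightFactor : ℕ → ℕ → ℕ → ℤ
  weightFactor e q x = signℤ e * (+ (2 ^ q) * + (diam G ^ x))

  weightFactor-+ : ∀ e e′ q q′ x x′ →
    weightFactor (e ℕ.+ e′) (q ℕ.+ q′) (x ℕ.+ x′) ≡ weightFactor e q x * weightFactor e′ q′ x′
  weightFactor-+ e e′ q q′ x x′ =
    trans (cong₂ _*_ (ℤ.^-distribˡ-+-* _ e e′) (cong₂ _*_ (pos-^-+ 2 q q′) (pos-^-+ (diam G) x x′)))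
          (regroup (signℤ e) (signℤ e′) (+ (2 ^ q)) (+ (2 ^ q′)) (+ (diam G ^ x)) (+ (diam G ^ x′)))
    where
    pos-^-+ : ∀ m a b → + (m ^ (a ℕ.+ b)) ≡ + (m ^ a) * + (m ^ b)
    pos-^-+ m a b = trans (cong +_ (ℕ.^-distribˡ-+-* m a b)) (ℤ.pos-* (m ^ a) (m ^ b))
    regroup : ∀ s s′ a a′ b b′ → s * s′ * (a * a′ * (b * b′)) ≡ s * (a * b) * (s′ * (a′ * b′))
    regroup = solve-∀

  longPart : List (Fin n) → ℕ
  longPart P = if isPairPart G P then 0 else 1

  antipodalCount : List (Fin n) → ℕ
  antipodalCount P = count G antipodal (cyclePairs P)

  partWeight-factor : ∀ u s → EdgesValid (u ∷ s) →
    partWeight (u ∷ s) ≡ signℤ (length s) * (orientations s * + (diam G ^ antipodalCount (u ∷ s)))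
  partWeight-factor u s valid =
    trans (x∙yz≈y∙xz (orientations s) (signℤ (length s)) (pairsProduct (cyclePairs (u ∷ s))))
          (cong (λ p → signℤ (length s) * (orientations s * p)) (pairsProduct-valid (cyclePairs (u ∷ s)) valid))

  partWeight-valid : ∀ {P} → ValidPart G P → partWeight P ≡ weightFactor (length P ∸ 1) (longPart P) (antipodalCount P)
  partWeight-valid {u ∷ s@(_ ∷ [])}    (_ , _ , valid) = partWeight-factor u s valid
  partWeight-valid {u ∷ s@(_ ∷ _ ∷ _)} (_ , _ , valid) = partWeight-factor u s valid

  p₁S-∷ : ∀ {P} S → ValidPart G P → longPart P ℕ.+ p₁S G S ≡ p₁S G (P ∷ S)
  p₁S-∷ {_ ∷ _ ∷ []}    S _ = refl
  p₁S-∷ {_ ∷ _ ∷ _ ∷ _} S _ = refl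

  antipodal-∷ : ∀ {P} S → ValidPart G P →
    antipodalCount P ℕ.+ (2 ℕ.* aS G S ℕ.+ a₁S G S) ≡ 2 ℕ.* aS G (P ∷ S) ℕ.+ a₁S G (P ∷ S)
  antipodal-∷ {u ∷ v ∷ []} S _ =
    trans (cong (λ b′ → (if b then suc (if b′ then 1 else 0) else (if b′ then 1 else 0)) ℕ.+ (2 ℕ.* aS G S ℕ.+ a₁S G S))
                (isAntipodal-sym v u))
          (both-directions b (aS G S) (a₁S G S))
    where
    b = isAntipodal G u v
    both-directions : ∀ b a a₁ → (if b then suc (if b then 1 else 0) else (if b then 1 else 0)) ℕ.+ (2 ℕ.* a ℕ.+ a₁) ≡
                                 2 ℕ.* (if b then suc a else a) ℕ.+ a₁
    both-directions true  a a₁ = trans (≡.sym (ℕ.+-assoc 2 (2 ℕ.* a) a₁)) (cong (ℕ._+ a₁) (≡.sym (ℕ.*-suc 2 a)))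
    both-directions false a a₁ = refl
  antipodal-∷ {P@(_ ∷ _ ∷ _ ∷ _)} S _ = ℕ+.x∙yz≈y∙xz (antipodalCount P) (2 ℕ.* aS G S) (a₁S G S)

  length≤length-concat : ∀ {S} → All (ValidPart G) S → length S ≤ length (concat S)
  length≤length-concat {[]}          []       = ℕ.z≤n
  length≤length-concat {(u ∷ P) ∷ S} (_ ∷ vS) =
    ℕ.s≤s (ℕ.≤-trans (length≤length-concat vS)
                     (subst (length (concat S) ≤_) (≡.sym (List.length-++ P)) (ℕ.m≤n+m _ (length P))))

  excess-∷ : ∀ (P : List (Fin n)) S → 1 ≤ length P → length S ≤ length (concat S) →
    (length P ∸ 1) ℕ.+ (length (concat S) ∸ length S) ≡ length (concat (P ∷ S)) ∸ length (P ∷ S)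
  excess-∷ (u ∷ P) S _ S≤ = begin
      length P ℕ.+ (length (concat S) ∸ length S)  ≡⟨ ℕ.+-∸-assoc (length P) S≤ ⟨
      (length P ℕ.+ length (concat S)) ∸ length S  ≡⟨ cong (_∸ length S) (List.length-++ P) ⟨
      length (P ++ concat S) ∸ length S          ∎
    where open ≡-Reasoning

  partitionWeight≡weightFactor : ∀ {S} → All (ValidPart G) S →
    partitionWeight S ≡ weightFactor (length (concat S) ∸ length S) (p₁S G S) (2 ℕ.* aS G S ℕ.+ a₁S G S)
  partitionWeight≡weightFactor {[]}    []        = refl
  partitionWeight≡weightFactor {P ∷ S} (vP ∷ vS) = begin
      partWeight P * partitionWeight S
    ≡⟨ cong₂ _*_ (partWeight-valid vP) (partitionWeight≡weightFactor vS) ⟩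
      weightFactor (length P ∸ 1) (longPart P) (antipodalCount P) *
      weightFactor (length (concat S) ∸ length S) (p₁S G S) (2 ℕ.* aS G S ℕ.+ a₁S G S)
    ≡⟨ weightFactor-+ (length P ∸ 1) (length (concat S) ∸ length S) (longPart P) (p₁S G S)
                      (antipodalCount P) (2 ℕ.* aS G S ℕ.+ a₁S G S) ⟨
      weightFactor (length P ∸ 1 ℕ.+ (length (concat S) ∸ length S)) (longPart P ℕ.+ p₁S G S)
                   (antipodalCount P ℕ.+ (2 ℕ.* aS G S ℕ.+ a₁S G S))
    ≡⟨ cong₃ weightFactor (excess-∷ P S (nonempty vP) (length≤length-concat vS))
                          (p₁S-∷ S vP) (antipodal-∷ S vP) ⟩
      weightFactor (length (concat (P ∷ S)) ∸ length (P ∷ S)) (p₁S G (P ∷ S))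
                   (2 ℕ.* aS G (P ∷ S) ℕ.+ a₁S G (P ∷ S))
    ∎
    where
    open ≡-Reasoning
    cong₃ : ∀ (f : ℕ → ℕ → ℕ → ℤ) {a a′ b b′ c c′} → a ≡ a′ → b ≡ b′ → c ≡ c′ →
            f a b c ≡ f a′ b′ c′
    cong₃ f refl refl refl = refl
    nonempty : ∀ {P} → ValidPart G P → 1 ≤ length P
    nonempty {_ ∷ _} _ = ℕ.s≤s ℕ.z≤n

  count+count-not : ∀ {A : Set} (f : A → Bool) xs → count G f xs ℕ.+ count G (not ∘ f) xs ≡ length xs
  count+count-not f []       = refl
  count+count-not f (x ∷ xs) with f x
  ... | true  = cong suc (count+count-not f xs)
  ... | false = trans (ℕ.+-suc _ _) (cong suc (count+count-not f xs))

  weight≡partitionWeight : ∀ {S} → SpanningADPartition G S → weight G S ≡ partitionWeight S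
  weight≡partitionWeight {S} (valid , _ , S↭) =
    trans (cong (λ e → weightFactor e (p₁S G S) (2 ℕ.* aS G S ℕ.+ a₁S G S)) excess)
          (≡.sym (partitionWeight≡weightFactor valid))
    where
    excess : n ∸ pS G S ∸ p₁S G S ≡ length (concat S) ∸ length S
    excess = begin
      n ∸ pS G S ∸ p₁S G S                    ≡⟨ ℕ.∸-+-assoc n (pS G S) (p₁S G S) ⟩
      n ∸ (pS G S ℕ.+ p₁S G S)                ≡⟨ cong₂ _∸_ (≡.sym (trans (↭.↭-length S↭) (List.length-tabulate (λ i → i))))
                                                             (count+count-not (isPairPart G) S) ⟩
      length (concat S) ∸ length S            ∎
      where open ≡-Reasoning

  partitionWeight-invalid : ∀ S → ¬ All EdgesValid S → partitionWeight S ≡ + 0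
  partitionWeight-invalid []      invalid = ⊥-elim (invalid [])
  partitionWeight-invalid (P ∷ S) invalid with edgesValid? P
  ... | yes P-valid = trans (cong (partWeight P *_) (partitionWeight-invalid S (λ S-valid → invalid (P-valid ∷ S-valid))))
                            (ℤ.*-zeroʳ (partWeight P))
  ... | no P-invalid = trans (cong (_* partitionWeight S) (partWeight-invalid P P-invalid)) (ℤ.*-zeroˡ (partitionWeight S))
    where
    partWeight-invalid : ∀ P → ¬ EdgesValid P → partWeight P ≡ + 0
    partWeight-invalid []      invalid = ⊥-elim (invalid [])
    partWeight-invalid (u ∷ s) invalid =
      trans (cong (λ p → orientations s * (signℤ (length s) * p)) (pairsProduct-invalid (cyclePairs (u ∷ s)) invalid))
            (trans (cong (orientations s *_) (ℤ.*-zeroʳ (signℤ (length s)))) (ℤ.*-zeroʳ (orientations s)))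

  spanning⇔ : ∀ {S} → SpanningADPartition G S ⇔ (CyclePartition (allFin n) S × All EdgesValid S)
  spanning⇔ = mk⇔
    (λ (valid , linked , S↭) → (All.map (λ (c , u , _) → c , u) valid , linked , S↭) , All.map (proj₂ ∘ proj₂) valid)
    (λ ((cycles , linked , S↭) , edges) → All.zipWith (λ ((c , u) , e) → c , u , e) (cycles , edges) , linked , S↭)

  adPartitions : List (List (List (Fin n)))
  adPartitions = filter (All.all? edgesValid?) (cyclePartitions n (allFin n))

  adPartitions-unique : Unique adPartitions
  adPartitions-unique = Unique.filter⁺ _ (cyclePartitions-unique n (Unique.allFin⁺ n))

  ∈-adPartitions : ∀ {S} → S ∈ adPartitions ⇔ SpanningADPartition G S
  ∈-adPartitions = mk⇔
    (λ S∈ → let S∈cp , edges = ∈-filter⁻ (All.all? edgesValid?) S∈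
            in Equivalence.from spanning⇔ (cyclePartitions-sound n sorted |allFin|≤n S∈cp , edges))
    (λ S-spans → let cycles , edges = Equivalence.to spanning⇔ S-spans
                 in ∈-filter⁺ (All.all? edgesValid?) (cyclePartitions-complete n sorted |allFin|≤n cycles) edges)
    where
    sorted : AllPairs _<_ (allFin n)
    sorted = AllPairs.tabulate⁺-< (λ i<j → i<j)
    |allFin|≤n : length (allFin n) ≤ n
    |allFin|≤n = ℕ.≤-reflexive (List.length-tabulate (λ i → i))

  minor≡∑adPartitions : Minor.minor (AD G) (allFin n) (allFin n) ≡ ∑ partitionWeight adPartitions
  minor≡∑adPartitions =
    trans (minor≡∑cyclePartitions n (Unique.allFin⁺ n) (ℕ.≤-reflexive (List.length-tabulate (λ i → i))))
          (≡.sym (∑-filter-vanishing (All.all? edgesValid?) partitionWeight (cyclePartitions n (allFin n))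
                                     (λ _ → partitionWeight-invalid _)))

mainTheorem4 : ∀ (n : ℕ) (G : Graph n) → Connected G →
    ∀ (Ss : List (List (List (Fin n)))) → Unique Ss →
    (∀ S → (S ∈ Ss) ⇔ SpanningADPartition G S) →
    det n (AD G) ≡ sumℤ (Data.List.map (weight G) Ss)
mainTheorem4 n G _ Ss Ss! Ss⇔ = begin
    det n (AD G)
  ≡⟨ Minor.det≡minor (AD G) n (λ i → i) (λ i → i) ⟩
    Minor.minor (AD G) (allFin n) (allFin n)
  ≡⟨ minor≡∑adPartitions ⟩
    ∑ partitionWeight adPartitions
  ≡⟨ ∑-↭ partitionWeight (↭-unique adPartitions-unique Ss! same-members) ⟩
    ∑ partitionWeight Ss
  ≡⟨ ∑-cong Ss (λ {S} S∈ → weight≡partitionWeight (Equivalence.to (Ss⇔ S) S∈)) ⟨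
    ∑ (weight G) Ss
  ∎
  where
  open ≡-Reasoning
  open AdjacencyDiametrical G
  open CycleExpansion (AD G) (Distances.AD-sym G) (Distances.AD-diag G) using (partitionWeight)
  same-members : ∀ {S} → S ∈ adPartitions ⇔ S ∈ Ss
  same-members {S} = ⇔.trans ∈-adPartitions (⇔.sym (Ss⇔ S))
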